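{- Fix natural numbers $i<n$ and put $j:=n-i>0$. Let $\Delta$ be the triangle with vertices $(0,0)$, $(i,0)$, $(i,j)$, and let $L$ be the segment from $(0,0)$ to $(i,j)$. Let $C$ be the set of all convex polygons with lattice-point vertices which lie in $\Delta$, do not touch the horizontal and vertical edges of $\Delta$ (other than at the endpoints $(0,0)$ and $(i,j)$ of $L$), and contain $L$ as an edge (segments count as $2$-gons, so $L\in C$). For $P\in C$ let $u(P)$ be the number of lattice points in the interior of $\Delta$ that do not lie in $P$, and let $v(P)$ be the number of vertices of $P$. Then, as polynomials in $x$, \[\sum_{P\in C}x^{u(P)} (1-x)^{v(P)-2}=1.\]
   Context: Natural numbers are positive integers; a lattice point is a point of $\mathbb{Z}^2$. -}

module Defs where

open import Data.Nat as ℕ using (ℕ; zero; suc)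
open import Data.Integer as ℤ using (ℤ; +_)
open import Data.Rational as ℚ using (ℚ; 0ℚ; 1ℚ; _≤_; _<_)
open import Data.Bool using (Bool; true; false)
open import Data.Fin using (Fin; toℕ)
open import Data.List using (List; []; _∷_; _++_; map; concatMap; length; filter; removeAt; lookup; filterᵇ; allFin; foldr)
open import Data.List.Relation.Unary.All using (All)
open import Data.List.Membership.Propositional using (_∈_)
open import Data.Vec as Vec using (Vec)
open import Data.Product using (Σ; _×_; _,_; proj₁; proj₂; ∃)
open import Data.Sum using (_⊎_)
open import Relation.Nullary using (¬_; Dec; yes; no)
open import Relation.Binary.PropositionalEquality using (_≡_; _≢_)

-- Polynomials in one variable x over ℤ, as coefficient lists
-- (constant term first).  Two polynomials are equal iff all their
-- coefficients agree (see `coeff`).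

Poly : Set
Poly = List ℤ

_⊕_ : Poly → Poly → Poly
[] ⊕ q = q
(a ∷ p) ⊕ [] = a ∷ p
(a ∷ p) ⊕ (b ∷ q) = (a ℤ.+ b) ∷ (p ⊕ q)

scale : ℤ → Poly → Poly
scale c = map (c ℤ.*_)

_⊗_ : Poly → Poly → Poly
[] ⊗ q = []
(a ∷ p) ⊗ q = scale a q ⊕ (+ 0 ∷ (p ⊗ q))

pone : Poly
pone = + 1 ∷ []

px : Poly
px = + 0 ∷ + 1 ∷ []

oneMinusX : Poly
oneMinusX = + 1 ∷ ℤ.-[1+ 0 ] ∷ []

_^ᵖ_ : Poly → ℕ → Poly
p ^ᵖ zero = pone
p ^ᵖ suc n = p ⊗ (p ^ᵖ n)

psum : List Poly → Poly
psum = foldr _⊕_ []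

coeff : Poly → ℕ → ℤ
coeff [] k = + 0
coeff (a ∷ p) zero = a
coeff (a ∷ p) (suc k) = coeff p k

-- The plane: points with rational coordinates (enough for all the
-- notions involved, since all polygons have lattice vertices).

Pt : Set
Pt = ℚ × ℚ

ℕtoℚ : ℕ → ℚ
ℕtoℚ a = (+ a) ℚ./ 1

latt : ℕ → ℕ → Pt
latt a b = ℕtoℚ a , ℕtoℚ b

combo : List ℚ → List Pt → Pt
combo (w ∷ ws) ((x , y) ∷ vs) =
  let r = combo ws vs in (w ℚ.* x ℚ.+ proj₁ r) , (w ℚ.* y ℚ.+ proj₂ r)
combo _ _ = 0ℚ , 0ℚ

qsum : List ℚ → ℚ
qsum = foldr ℚ._+_ 0ℚ

InConv : List Pt → Pt → Set
InConv V q = Σ (List ℚ) λ ws →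
  (length ws ≡ length V) × All (0ℚ ≤_) ws × (qsum ws ≡ 1ℚ) × (combo ws V ≡ q)

InSeg : Pt → Pt → Pt → Set
InSeg a b = InConv (a ∷ b ∷ [])

-- V is in convex position: no listed point lies in the hull of the others
-- (so V is exactly the vertex set of the polygon conv V).
ConvexPosition : List Pt → Set
ConvexPosition V = (k : Fin (length V)) → ¬ InConv (removeAt V k) (lookup V k)

lin : ℚ → ℚ → Pt → ℚ
lin α β (x , y) = α ℚ.* x ℚ.+ β ℚ.* y

IsEdge : List Pt → Pt → Pt → Set
IsEdge V a b = (a ≢ b) × (a ∈ V) × (b ∈ V) ×
  Σ ℚ λ α → Σ ℚ λ β → Σ ℚ λ γ →
    ¬ (α ≡ 0ℚ × β ≡ 0ℚ) ×
    (∀ q → InConv V q → lin α β q ≤ γ) ×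
    (∀ q → InConv V q → lin α β q ≡ γ → InSeg a b q) ×
    (lin α β a ≡ γ) × (lin α β b ≡ γ)

module _ (i j : ℕ) where
  private
    I J : ℚ
    I = ℕtoℚ i
    J = ℕtoℚ j

  InΔ : Pt → Set
  InΔ (x , y) = (0ℚ ≤ y) × (x ≤ I) × (y ℚ.* I ≤ J ℚ.* x)

  IntΔ : Pt → Set
  IntΔ (x , y) = (0ℚ < y) × (x < I) × (y ℚ.* I < J ℚ.* x)

  OnHoriz : Pt → Set
  OnHoriz (x , y) = (y ≡ 0ℚ) × (0ℚ ≤ x) × (x ≤ I)

  OnVert : Pt → Set
  OnVert (x , y) = (x ≡ I) × (0ℚ ≤ y) × (y ≤ J)

  origin corner : Pt
  origin = latt 0 0
  corner = latt i j

  -- A candidate polygon is given by its vertex set, a subset of the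
  -- lattice points of the box [0,i]×[0,j] ⊇ Δ (S a b = true iff (a,b) is a vertex).
  Grid : Set
  Grid = Vec (Vec Bool (suc j)) (suc i)

  gridPts : List (Fin (suc i) × Fin (suc j))
  gridPts = concatMap (λ a → map (λ b → a , b) (allFin (suc j))) (allFin (suc i))

  toPt : Fin (suc i) × Fin (suc j) → Pt
  toPt (a , b) = latt (toℕ a) (toℕ b)

  vertices : Grid → List Pt
  vertices S = map toPt (filterᵇ (λ ab → Vec.lookup (Vec.lookup S (proj₁ ab)) (proj₂ ab)) gridPts)

  InC : Grid → Set
  InC S = let V = vertices S in
    ConvexPosition V ×
    (∀ q → InConv V q → InΔ q) ×
    (∀ q → InConv V q → OnHoriz q ⊎ OnVert q → (q ≡ origin) ⊎ (q ≡ corner)) ×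
    IsEdge V origin corner

  allVecs : {A : Set} → (n : ℕ) → List A → List (Vec A n)
  allVecs zero xs = Vec.[] ∷ []
  allVecs (suc n) xs = concatMap (λ x → map (x Vec.∷_) (allVecs n xs)) xs

  allGrids : List Grid
  allGrids = allVecs (suc i) (allVecs (suc j) (true ∷ false ∷ []))

  -- u(P): number of lattice points of the interior of Δ not in P
  -- (all such points lie in the box, so we count over gridPts);
  -- v(P): number of vertices.
  module _ (decConv : (V : List Pt) (q : Pt) → Dec (InConv V q)) where
    decU : (V : List Pt) (q : Pt) → Dec (IntΔ q × ¬ InConv V q)
    decU V (x , y) with 0ℚ ℚ.<? y | x ℚ.<? I | y ℚ.* I ℚ.<? J ℚ.* x | decConv V (x , y)
    ... | yes p | yes p' | yes p'' | no c = yes ((p , p' , p'') , c)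
    ... | no ¬p | _ | _ | _ = no λ z → ¬p (proj₁ (proj₁ z))
    ... | yes _ | no ¬p | _ | _ = no λ z → ¬p (proj₁ (proj₂ (proj₁ z)))
    ... | yes _ | yes _ | no ¬p | _ = no λ z → ¬p (proj₂ (proj₂ (proj₁ z)))
    ... | yes _ | yes _ | yes _ | yes c = no λ z → proj₂ z c

    u : Grid → ℕ
    u S = length (filter (decU (vertices S)) (map toPt gridPts))

    v : Grid → ℕ
    v S = length (vertices S)

    term : Grid → Poly
    term S = (px ^ᵖ u S) ⊗ (oneMinusX ^ᵖ (v S ℕ.∸ 2))

    sumC : ((S : Grid) → Dec (InC S)) → Poly
    sumC decC = psum (map term (filter decC allGrids))

{-# OPTIONS --safe #-}
-- Expanding 1 = ∏ ((1 - x) + x) over the lattice points p of the interior of Δ gives one term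
-- x^{#(interior ∖ S)} (1 - x)^{#S} for every set S of interior points.  Group the sets S by the polygon
-- P = conv (S ∪ L): it lies in C (its vertices are O, C and interior points, and it cannot touch
-- the legs of Δ elsewhere), and the sets in the group of P are exactly those with
-- vertices(P) ⊆ S ⊆ P.  Summing over the free choice at the non-vertex interior points of P
-- contributes a factor (1 - x) + x = 1 for each, which leaves x^{u(P)} (1 - x)^{v(P) - 2}.
-- Sets and polygons are Boolean grids on [0,i] × [0,j]; the vertices of conv S are found by
-- repeatedly discarding a point that lies in the hull of the others.
module Submission where

module RationalFacts where

  open import Data.Integer using (+≤+; +<+)
  open import Data.Nat using (z≤n; s≤s)
  open import Data.Rational as ℚ using (ℚ; 0ℚ; 1ℚ; _≤_; _<_; _+_; _*_; _-_; -_; 1/_; NonZero)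
  import Data.Rational.Properties as ℚP
  open import Data.Rational.Solver
  open +-*-Solver
  open import Relation.Binary.PropositionalEquality
  open import Relation.Nullary using (yes; no)
  open import Data.Empty using (⊥-elim)
  open import Data.Sum using (_⊎_; inj₁; inj₂)
  open import Function using (_∘_)
  open import Relation.Binary.Definitions using (tri<; tri≈; tri>)

  0≤1 : 0ℚ ≤ 1ℚ
  0≤1 = ℚ.*≤* (+≤+ z≤n)

  0<1 : 0ℚ < 1ℚ
  0<1 = ℚ.*<* (+<+ (s≤s z≤n))

  nonNeg-+ : ∀ {p q} → 0ℚ ≤ p → 0ℚ ≤ q → 0ℚ ≤ p + q
  nonNeg-+ {p} {q} 0≤p 0≤q = subst (_≤ p + q) (ℚP.+-identityˡ 0ℚ) (ℚP.+-mono-≤ 0≤p 0≤q)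

  nonNeg-* : ∀ {p q} → 0ℚ ≤ p → 0ℚ ≤ q → 0ℚ ≤ p * q
  nonNeg-* {p} {q} 0≤p 0≤q = ℚP.nonNegative⁻¹ (p * q) {{ℚP.nonNeg*nonNeg⇒nonNeg p {{ℚ.nonNegative 0≤p}} q {{ℚ.nonNegative 0≤q}}}}

  pos-* : ∀ {p q} → 0ℚ < p → 0ℚ < q → 0ℚ < p * q
  pos-* {p} {q} 0<p 0<q = ℚP.positive⁻¹ (p * q) {{ℚP.pos*pos⇒pos p {{ℚ.positive 0<p}} q {{ℚ.positive 0<q}}}}

  p≤q⇒0≤q-p : ∀ {p q} → p ≤ q → 0ℚ ≤ q - p
  p≤q⇒0≤q-p {p} p≤q = subst₂ _≤_ (ℚP.+-inverseʳ p) refl (ℚP.+-monoˡ-≤ (- p) p≤q)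

  0≤q-p⇒p≤q : ∀ {p q} → 0ℚ ≤ q - p → p ≤ q
  0≤q-p⇒p≤q {p} {q} 0≤q-p = subst₂ _≤_ (ℚP.+-identityˡ p) (q-p+p≡q p q) (ℚP.+-monoˡ-≤ p 0≤q-p)
    where
    q-p+p≡q : ∀ p q → (q - p) + p ≡ q
    q-p+p≡q = solve 2 (λ p q → (q :- p) :+ p := q) refl

  p<q⇒0<q-p : ∀ {p q} → p < q → 0ℚ < q - p
  p<q⇒0<q-p {p} p<q = subst₂ _<_ (ℚP.+-inverseʳ p) refl (ℚP.+-monoˡ-< (- p) p<q)

  ≤∧≢⇒< : ∀ {p q} → p ≤ q → p ≢ q → p < q
  ≤∧≢⇒< {p} {q} p≤q p≢q with ℚP.<-cmp p q
  ... | tri< p<q _ _ = p<q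
  ... | tri≈ _ p≡q _ = ⊥-elim (p≢q p≡q)
  ... | tri> _ _ q<p = ⊥-elim (ℚP.<-irrefl refl (ℚP.<-≤-trans q<p p≤q))

  0≤p⇒p≡0⊎0<p : ∀ {p} → 0ℚ ≤ p → (p ≡ 0ℚ) ⊎ (0ℚ < p)
  0≤p⇒p≡0⊎0<p {p} 0≤p with p ℚP.≟ 0ℚ
  ... | yes p≡0 = inj₁ p≡0
  ... | no  p≢0 = inj₂ (≤∧≢⇒< 0≤p (p≢0 ∘ sym))

  p+q≡0⇒p≡0 : ∀ {p q} → 0ℚ ≤ p → 0ℚ ≤ q → p + q ≡ 0ℚ → p ≡ 0ℚ
  p+q≡0⇒p≡0 {p} {q} 0≤p 0≤q p+q≡0 with 0≤p⇒p≡0⊎0<p 0≤p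
  ... | inj₁ p≡0 = p≡0
  ... | inj₂ 0<p = ⊥-elim (ℚP.<-irrefl (sym p+q≡0) 0<p+q)
    where
    0<p+q : 0ℚ < p + q
    0<p+q = subst (_< p + q) (ℚP.+-identityˡ 0ℚ) (ℚP.+-mono-<-≤ 0<p 0≤q)

  p*q≡0⇒p≡0 : ∀ {p q} → p * q ≡ 0ℚ → q ≢ 0ℚ → p ≡ 0ℚ
  p*q≡0⇒p≡0 {p} {q} pq≡0 q≢0 = begin
      p                ≡⟨ sym (ℚP.*-identityʳ p) ⟩
      p * 1ℚ           ≡⟨ cong (p *_) (sym (ℚP.*-inverseʳ q)) ⟩
      p * (q * (1/ q)) ≡⟨ sym (ℚP.*-assoc p q _) ⟩
      (p * q) * (1/ q) ≡⟨ cong (_* (1/ q)) pq≡0 ⟩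
      0ℚ * (1/ q)      ≡⟨ ℚP.*-zeroˡ (1/ q) ⟩
      0ℚ               ∎
    where
    open ≡-Reasoning
    instance
      q-nonZero : NonZero q
      q-nonZero = ℚ.≢-nonZero q≢0

module BoolFacts where

  open import Data.Bool using (Bool; true; false; _∧_; _∨_; not)
  open import Data.Empty using (⊥)
  open import Data.Product using (_×_; _,_)
  open import Relation.Nullary using (Dec; yes; does)
  open import Relation.Binary.PropositionalEquality

  does-sound : ∀ {P : Set} (d : Dec P) → does d ≡ true → P
  does-sound (yes p) _ = p

  true≢false : true ≡ false → ⊥
  true≢false ()

  Bool-ext : ∀ {a b : Bool} → (a ≡ true → b ≡ true) → (b ≡ true → a ≡ true) → a ≡ b
  Bool-ext {false} {false} _   _   = refl
  Bool-ext {false} {true}  _   b⇒a = b⇒a refl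
  Bool-ext {true}  {false} a⇒b _   = sym (a⇒b refl)
  Bool-ext {true}  {true}  _   _   = refl

  ∧-true⁻ : ∀ {a b} → a ∧ b ≡ true → (a ≡ true) × (b ≡ true)
  ∧-true⁻ {true} {true} _ = refl , refl

  ∧-not-true : ∀ {a b} → a ≡ true → b ≡ false → a ∧ not b ≡ true
  ∧-not-true refl refl = refl

  ∨-trueˡ : ∀ {a b} → a ≡ true → a ∨ b ≡ true
  ∨-trueˡ refl = refl

  ∨-trueʳ : ∀ {a b} → b ≡ true → a ∨ b ≡ true
  ∨-trueʳ {true}  refl = refl
  ∨-trueʳ {false} refl = refl

module PolynomialAlgebra where

  open import Defs
  open import Data.Nat using (zero; suc)
  open import Data.Integer as ℤ using (ℤ; +_)
  import Data.Integer.Properties as ℤP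
  open import Data.Integer.Solver
  open +-*-Solver
  open import Data.List using ([]; _∷_)
  open import Level using (0ℓ)
  open import Relation.Binary.Bundles using (Setoid)
  open import Relation.Binary.PropositionalEquality
  import Relation.Binary.Reasoning.Setoid as SetoidReasoning

  infix 4 _≈_
  record _≈_ (p q : Poly) : Set where
    constructor mk
    field at : ∀ k → coeff p k ≡ coeff q k
  open _≈_ public

  ≈-refl : ∀ {p} → p ≈ p
  ≈-refl = mk λ k → refl

  ≈-sym : ∀ {p q} → p ≈ q → q ≈ p
  ≈-sym p≈q = mk λ k → sym (at p≈q k)

  ≈-trans : ∀ {p q r} → p ≈ q → q ≈ r → p ≈ r
  ≈-trans p≈q q≈r = mk λ k → trans (at p≈q k) (at q≈r k)

  ≡⇒≈ : ∀ {p q} → p ≡ q → p ≈ q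
  ≡⇒≈ refl = ≈-refl

  ≈-setoid : Setoid 0ℓ 0ℓ
  ≈-setoid = record
    { Carrier = Poly ; _≈_ = _≈_
    ; isEquivalence = record { refl = ≈-refl ; sym = ≈-sym ; trans = ≈-trans } }

  module ≈-Reasoning = SetoidReasoning ≈-setoid

  ∷-cong : ∀ {a b p q} → a ≡ b → p ≈ q → a ∷ p ≈ b ∷ q
  ∷-cong a≡b p≈q = mk λ { zero → a≡b ; (suc k) → at p≈q k }

  ∷-≈[] : ∀ {a p} → a ≡ + 0 → p ≈ [] → a ∷ p ≈ []
  ∷-≈[] a≡0 p≈[] = mk λ { zero → a≡0 ; (suc k) → at p≈[] k }

  coeff-⊕ : ∀ p q k → coeff (p ⊕ q) k ≡ coeff p k ℤ.+ coeff q k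
  coeff-⊕ [] q k = sym (ℤP.+-identityˡ _)
  coeff-⊕ (a ∷ p) [] k = sym (ℤP.+-identityʳ _)
  coeff-⊕ (a ∷ p) (b ∷ q) zero = refl
  coeff-⊕ (a ∷ p) (b ∷ q) (suc k) = coeff-⊕ p q k

  coeff-scale : ∀ c p k → coeff (scale c p) k ≡ c ℤ.* coeff p k
  coeff-scale c [] k = sym (ℤP.*-zeroʳ c)
  coeff-scale c (a ∷ p) zero = refl
  coeff-scale c (a ∷ p) (suc k) = coeff-scale c p k

  ⊕-cong : ∀ {p p' q q'} → p ≈ p' → q ≈ q' → p ⊕ q ≈ p' ⊕ q'
  ⊕-cong {p} {p'} {q} {q'} p≈p' q≈q' = mk λ k →
    trans (coeff-⊕ p q k) (trans (cong₂ ℤ._+_ (at p≈p' k) (at q≈q' k)) (sym (coeff-⊕ p' q' k)))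

  ⊕-comm : ∀ p q → p ⊕ q ≈ q ⊕ p
  ⊕-comm p q = mk λ k → trans (coeff-⊕ p q k) (trans (ℤP.+-comm (coeff p k) _) (sym (coeff-⊕ q p k)))

  ⊕-assoc : ∀ p q r → (p ⊕ q) ⊕ r ≈ p ⊕ (q ⊕ r)
  ⊕-assoc p q r = mk λ k → begin
    coeff ((p ⊕ q) ⊕ r) k                   ≡⟨ trans (coeff-⊕ (p ⊕ q) r k) (cong (ℤ._+ coeff r k) (coeff-⊕ p q k)) ⟩
    coeff p k ℤ.+ coeff q k ℤ.+ coeff r k   ≡⟨ ℤP.+-assoc (coeff p k) _ _ ⟩
    coeff p k ℤ.+ (coeff q k ℤ.+ coeff r k) ≡⟨ sym (trans (coeff-⊕ p (q ⊕ r) k) (cong (λ z → coeff p k ℤ.+ z) (coeff-⊕ q r k))) ⟩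
    coeff (p ⊕ (q ⊕ r)) k                   ∎
    where open ≡-Reasoning

  ⊕-identityʳ : ∀ p → p ⊕ [] ≈ p
  ⊕-identityʳ p = mk λ k → trans (coeff-⊕ p [] k) (ℤP.+-identityʳ _)

  ⊕-swap : ∀ p q r → p ⊕ (q ⊕ r) ≈ q ⊕ (p ⊕ r)
  ⊕-swap p q r = begin
    p ⊕ (q ⊕ r) ≈⟨ ⊕-assoc p q r ⟨
    (p ⊕ q) ⊕ r ≈⟨ ⊕-cong (⊕-comm p q) ≈-refl ⟩
    (q ⊕ p) ⊕ r ≈⟨ ⊕-assoc q p r ⟩
    q ⊕ (p ⊕ r) ∎
    where open ≈-Reasoning

  ⊕-interchange : ∀ p q r s → (p ⊕ q) ⊕ (r ⊕ s) ≈ (p ⊕ r) ⊕ (q ⊕ s)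
  ⊕-interchange p q r s = begin
    (p ⊕ q) ⊕ (r ⊕ s) ≈⟨ ⊕-assoc p q _ ⟩
    p ⊕ (q ⊕ (r ⊕ s)) ≈⟨ ⊕-cong (≈-refl {p}) (⊕-swap q r s) ⟩
    p ⊕ (r ⊕ (q ⊕ s)) ≈⟨ ⊕-assoc p r _ ⟨
    (p ⊕ r) ⊕ (q ⊕ s) ∎
    where open ≈-Reasoning

  shift : Poly → Poly
  shift p = + 0 ∷ p

  shift-[] : shift [] ≈ []
  shift-[] = ∷-≈[] refl ≈-refl

  shift-cong : ∀ {p q} → p ≈ q → shift p ≈ shift q
  shift-cong = ∷-cong refl

  shift-⊕ : ∀ p q → shift (p ⊕ q) ≈ shift p ⊕ shift q
  shift-⊕ p q = ∷-cong refl ≈-refl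

  scale-cong : ∀ c {p q} → p ≈ q → scale c p ≈ scale c q
  scale-cong c {p} {q} p≈q = mk λ k →
    trans (coeff-scale c p k) (trans (cong (c ℤ.*_) (at p≈q k)) (sym (coeff-scale c q k)))

  scale-0 : ∀ p → scale (+ 0) p ≈ []
  scale-0 p = mk λ k → trans (coeff-scale (+ 0) p k) (ℤP.*-zeroˡ (coeff p k))

  scale-1 : ∀ p → scale (+ 1) p ≈ p
  scale-1 p = mk λ k → trans (coeff-scale (+ 1) p k) (ℤP.*-identityˡ _)

  scale-* : ∀ c d p → scale (c ℤ.* d) p ≈ scale c (scale d p)
  scale-* c d p = mk λ k → begin
    coeff (scale (c ℤ.* d) p) k ≡⟨ coeff-scale (c ℤ.* d) p k ⟩
    c ℤ.* d ℤ.* coeff p k       ≡⟨ ℤP.*-assoc c d _ ⟩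
    c ℤ.* (d ℤ.* coeff p k)     ≡⟨ sym (trans (coeff-scale c (scale d p) k) (cong (c ℤ.*_) (coeff-scale d p k))) ⟩
    coeff (scale c (scale d p)) k ∎
    where open ≡-Reasoning

  scale-+ : ∀ c d p → scale (c ℤ.+ d) p ≈ scale c p ⊕ scale d p
  scale-+ c d p = mk λ k → begin
    coeff (scale (c ℤ.+ d) p) k           ≡⟨ coeff-scale (c ℤ.+ d) p k ⟩
    (c ℤ.+ d) ℤ.* coeff p k               ≡⟨ ℤP.*-distribʳ-+ (coeff p k) c d ⟩
    c ℤ.* coeff p k ℤ.+ d ℤ.* coeff p k   ≡⟨ sym (trans (coeff-⊕ (scale c p) (scale d p) k) (cong₂ ℤ._+_ (coeff-scale c p k) (coeff-scale d p k))) ⟩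
    coeff (scale c p ⊕ scale d p) k       ∎
    where open ≡-Reasoning

  scale-⊕ : ∀ c p q → scale c (p ⊕ q) ≈ scale c p ⊕ scale c q
  scale-⊕ c p q = mk λ k → begin
    coeff (scale c (p ⊕ q)) k             ≡⟨ trans (coeff-scale c (p ⊕ q) k) (cong (c ℤ.*_) (coeff-⊕ p q k)) ⟩
    c ℤ.* (coeff p k ℤ.+ coeff q k)       ≡⟨ ℤP.*-distribˡ-+ c (coeff p k) _ ⟩
    c ℤ.* coeff p k ℤ.+ c ℤ.* coeff q k   ≡⟨ sym (trans (coeff-⊕ (scale c p) (scale c q) k) (cong₂ ℤ._+_ (coeff-scale c p k) (coeff-scale c q k))) ⟩
    coeff (scale c p ⊕ scale c q) k       ∎
    where open ≡-Reasoning

  scale-shift : ∀ c p → scale c (shift p) ≈ shift (scale c p)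
  scale-shift c p = ∷-cong (ℤP.*-zeroʳ c) ≈-refl

  ⊗-zeroʳ : ∀ p → p ⊗ [] ≈ []
  ⊗-zeroʳ [] = ≈-refl
  ⊗-zeroʳ (a ∷ p) = ∷-≈[] refl (⊗-zeroʳ p)

  ⊗-congʳ : ∀ p {q q'} → q ≈ q' → p ⊗ q ≈ p ⊗ q'
  ⊗-congʳ [] q≈q' = ≈-refl
  ⊗-congʳ (a ∷ p) q≈q' = ⊕-cong (scale-cong a q≈q') (shift-cong (⊗-congʳ p q≈q'))

  ⊗-identityˡ : ∀ p → pone ⊗ p ≈ p
  ⊗-identityˡ p = ≈-trans (⊕-cong (scale-1 p) shift-[]) (⊕-identityʳ p)

  shift-⊗ : ∀ p q → shift p ⊗ q ≈ shift (p ⊗ q)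
  shift-⊗ p q = ⊕-cong (scale-0 q) ≈-refl

  ⊗-distribˡ : ∀ p q r → p ⊗ (q ⊕ r) ≈ (p ⊗ q) ⊕ (p ⊗ r)
  ⊗-distribˡ [] q r = ≈-refl
  ⊗-distribˡ (a ∷ p) q r = begin
    scale a (q ⊕ r) ⊕ shift (p ⊗ (q ⊕ r))
      ≈⟨ ⊕-cong (scale-⊕ a q r) (shift-cong (⊗-distribˡ p q r)) ⟩
    (scale a q ⊕ scale a r) ⊕ shift ((p ⊗ q) ⊕ (p ⊗ r))
      ≈⟨ ⊕-cong (≈-refl {scale a q ⊕ scale a r}) (shift-⊕ (p ⊗ q) (p ⊗ r)) ⟩
    (scale a q ⊕ scale a r) ⊕ (shift (p ⊗ q) ⊕ shift (p ⊗ r))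
      ≈⟨ ⊕-interchange (scale a q) (scale a r) (shift (p ⊗ q)) (shift (p ⊗ r)) ⟩
    (scale a q ⊕ shift (p ⊗ q)) ⊕ (scale a r ⊕ shift (p ⊗ r)) ∎
    where open ≈-Reasoning

  ⊗-distribʳ : ∀ p q r → (p ⊕ q) ⊗ r ≈ (p ⊗ r) ⊕ (q ⊗ r)
  ⊗-distribʳ [] q r = ≈-refl
  ⊗-distribʳ (a ∷ p) [] r = ≈-sym (⊕-identityʳ _)
  ⊗-distribʳ (a ∷ p) (b ∷ q) r = begin
    scale (a ℤ.+ b) r ⊕ shift ((p ⊕ q) ⊗ r)
      ≈⟨ ⊕-cong (scale-+ a b r) (shift-cong (⊗-distribʳ p q r)) ⟩
    (scale a r ⊕ scale b r) ⊕ shift ((p ⊗ r) ⊕ (q ⊗ r))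
      ≈⟨ ⊕-cong (≈-refl {scale a r ⊕ scale b r}) (shift-⊕ (p ⊗ r) (q ⊗ r)) ⟩
    (scale a r ⊕ scale b r) ⊕ (shift (p ⊗ r) ⊕ shift (q ⊗ r))
      ≈⟨ ⊕-interchange (scale a r) (scale b r) (shift (p ⊗ r)) (shift (q ⊗ r)) ⟩
    (scale a r ⊕ shift (p ⊗ r)) ⊕ (scale b r ⊕ shift (q ⊗ r)) ∎
    where open ≈-Reasoning

  scale-⊗ : ∀ c p q → scale c p ⊗ q ≈ scale c (p ⊗ q)
  scale-⊗ c [] q = ≈-refl
  scale-⊗ c (a ∷ p) q = begin
    scale (c ℤ.* a) q ⊕ shift (scale c p ⊗ q)
      ≈⟨ ⊕-cong (scale-* c a q) (shift-cong (scale-⊗ c p q)) ⟩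
    scale c (scale a q) ⊕ shift (scale c (p ⊗ q))
      ≈⟨ ⊕-cong (≈-refl {scale c (scale a q)}) (scale-shift c (p ⊗ q)) ⟨
    scale c (scale a q) ⊕ scale c (shift (p ⊗ q))
      ≈⟨ scale-⊕ c (scale a q) _ ⟨
    scale c (scale a q ⊕ shift (p ⊗ q)) ∎
    where open ≈-Reasoning

  ⊗-assoc : ∀ p q r → (p ⊗ q) ⊗ r ≈ p ⊗ (q ⊗ r)
  ⊗-assoc [] q r = ≈-refl
  ⊗-assoc (a ∷ p) q r = begin
    (scale a q ⊕ shift (p ⊗ q)) ⊗ r          ≈⟨ ⊗-distribʳ (scale a q) (shift (p ⊗ q)) r ⟩
    (scale a q ⊗ r) ⊕ (shift (p ⊗ q) ⊗ r)    ≈⟨ ⊕-cong (scale-⊗ a q r) (shift-⊗ (p ⊗ q) r) ⟩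
    scale a (q ⊗ r) ⊕ shift ((p ⊗ q) ⊗ r)    ≈⟨ ⊕-cong (≈-refl {scale a (q ⊗ r)}) (shift-cong (⊗-assoc p q r)) ⟩
    scale a (q ⊗ r) ⊕ shift (p ⊗ (q ⊗ r))    ∎
    where open ≈-Reasoning

  ⊗-consʳ : ∀ q a p → q ⊗ (a ∷ p) ≈ scale a q ⊕ shift (q ⊗ p)
  ⊗-consʳ [] a p = ≈-sym shift-[]
  ⊗-consʳ (b ∷ q) a p = ∷-cong (cong (ℤ._+ + 0) (ℤP.*-comm b a)) (begin
    scale b p ⊕ (q ⊗ (a ∷ p))                ≈⟨ ⊕-cong (≈-refl {scale b p}) (⊗-consʳ q a p) ⟩
    scale b p ⊕ (scale a q ⊕ shift (q ⊗ p))  ≈⟨ ⊕-swap (scale b p) (scale a q) _ ⟩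
    scale a q ⊕ (scale b p ⊕ shift (q ⊗ p))  ∎)
    where open ≈-Reasoning

  ⊗-comm : ∀ p q → p ⊗ q ≈ q ⊗ p
  ⊗-comm [] q = ≈-sym (⊗-zeroʳ q)
  ⊗-comm (a ∷ p) q = ≈-trans (⊕-cong (≈-refl {scale a q}) (shift-cong (⊗-comm p q))) (≈-sym (⊗-consʳ q a p))

  ⊗-congˡ : ∀ {p p'} q → p ≈ p' → p ⊗ q ≈ p' ⊗ q
  ⊗-congˡ {p} {p'} q p≈p' = ≈-trans (⊗-comm p q) (≈-trans (⊗-congʳ q p≈p') (⊗-comm q p'))

  ⊗-cong : ∀ {p p' q q'} → p ≈ p' → q ≈ q' → p ⊗ q ≈ p' ⊗ q'
  ⊗-cong {p' = p'} {q = q} p≈p' q≈q' = ≈-trans (⊗-congˡ q p≈p') (⊗-congʳ p' q≈q')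

  ⊗-interchange : ∀ p q r s → (p ⊗ q) ⊗ (r ⊗ s) ≈ (p ⊗ r) ⊗ (q ⊗ s)
  ⊗-interchange p q r s = begin
    (p ⊗ q) ⊗ (r ⊗ s) ≈⟨ ⊗-assoc p q _ ⟩
    p ⊗ (q ⊗ (r ⊗ s)) ≈⟨ ⊗-congʳ p (⊗-assoc q r s) ⟨
    p ⊗ ((q ⊗ r) ⊗ s) ≈⟨ ⊗-congʳ p (⊗-congˡ s (⊗-comm q r)) ⟩
    p ⊗ ((r ⊗ q) ⊗ s) ≈⟨ ⊗-congʳ p (⊗-assoc r q s) ⟩
    p ⊗ (r ⊗ (q ⊗ s)) ≈⟨ ⊗-assoc p r _ ⟨
    (p ⊗ r) ⊗ (q ⊗ s) ∎
    where open ≈-Reasoning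

  oneMinusX⊕px≈pone : oneMinusX ⊕ px ≈ pone
  oneMinusX⊕px≈pone = mk λ { zero → refl ; (suc zero) → refl ; (suc (suc k)) → refl }

module BigOperators where

  open import Defs
  open PolynomialAlgebra
  open import Data.Nat using (ℕ; zero; suc)
  open import Data.Bool using (Bool; true; false)
  open import Data.Fin using (Fin; zero; suc)
  open import Data.List using (List; []; _∷_; _++_; map; foldr; concatMap; filter; tabulate)
  open import Data.List.Membership.Propositional using (_∈_)
  open import Data.List.Relation.Unary.Any using (here; there)
  open import Data.Vec as Vec using (Vec)
  open import Relation.Nullary using (does)
  open import Relation.Unary using (Pred; Decidable)
  open import Relation.Binary.PropositionalEquality
  open import Function using (_∘_)
  open import Level using (0ℓ)

  Σl : ∀ {A : Set} → List A → (A → Poly) → Poly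
  Σl xs f = psum (map f xs)

  Πl : ∀ {A : Set} → List A → (A → Poly) → Poly
  Πl xs f = foldr (λ a r → f a ⊗ r) pone xs

  indicator : Bool → Poly
  indicator true = pone
  indicator false = []

  Σl-cong : ∀ {A : Set} (xs : List A) {f g : A → Poly} → (∀ {x} → x ∈ xs → f x ≈ g x) → Σl xs f ≈ Σl xs g
  Σl-cong [] h = ≈-refl
  Σl-cong (x ∷ xs) h = ⊕-cong (h (here refl)) (Σl-cong xs (λ p → h (there p)))

  Σl-++ : ∀ {A : Set} (xs ys : List A) (f : A → Poly) → Σl (xs ++ ys) f ≈ Σl xs f ⊕ Σl ys f
  Σl-++ [] ys f = ≈-refl
  Σl-++ (x ∷ xs) ys f = ≈-trans (⊕-cong ≈-refl (Σl-++ xs ys f)) (≈-sym (⊕-assoc (f x) _ _))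

  Σl-map : ∀ {A B : Set} (g : A → B) (xs : List A) (f : B → Poly) → Σl (map g xs) f ≡ Σl xs (f ∘ g)
  Σl-map g [] f = refl
  Σl-map g (x ∷ xs) f = cong (f (g x) ⊕_) (Σl-map g xs f)

  Σl-concatMap : ∀ {A B : Set} (h : A → List B) (xs : List A) (f : B → Poly) → Σl (concatMap h xs) f ≈ Σl xs (λ x → Σl (h x) f)
  Σl-concatMap h [] f = ≈-refl
  Σl-concatMap h (x ∷ xs) f = ≈-trans (Σl-++ (h x) (concatMap h xs) f) (⊕-cong ≈-refl (Σl-concatMap h xs f))

  ⊗-Σl : ∀ {A : Set} (c : Poly) (xs : List A) (f : A → Poly) → c ⊗ Σl xs f ≈ Σl xs (λ x → c ⊗ f x)
  ⊗-Σl c [] f = ⊗-zeroʳ c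
  ⊗-Σl c (x ∷ xs) f = ≈-trans (⊗-distribˡ c (f x) _) (⊕-cong ≈-refl (⊗-Σl c xs f))

  Σl-⊗ : ∀ {A : Set} (c : Poly) (xs : List A) (f : A → Poly) → Σl xs f ⊗ c ≈ Σl xs (λ x → f x ⊗ c)
  Σl-⊗ c xs f = ≈-trans (⊗-comm _ c) (≈-trans (⊗-Σl c xs f) (Σl-cong xs (λ {x} _ → ⊗-comm c (f x))))

  Σl-⊕ : ∀ {A : Set} (xs : List A) (f g : A → Poly) → Σl xs (λ x → f x ⊕ g x) ≈ Σl xs f ⊕ Σl xs g
  Σl-⊕ [] f g = ≈-refl
  Σl-⊕ (x ∷ xs) f g = ≈-trans (⊕-cong (≈-refl {f x ⊕ g x}) (Σl-⊕ xs f g)) (⊕-interchange (f x) (g x) (Σl xs f) (Σl xs g))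

  Σl-swap : ∀ {A B : Set} (xs : List A) (ys : List B) (g : A → B → Poly) → Σl xs (λ x → Σl ys (g x)) ≈ Σl ys (λ y → Σl xs (λ x → g x y))
  Σl-swap [] ys g = ≈-sym (Σl-zero ys)
    where
    Σl-zero : ∀ {B : Set} (ys : List B) → Σl ys (λ y → []) ≈ []
    Σl-zero [] = ≈-refl
    Σl-zero (y ∷ ys) = Σl-zero ys
  Σl-swap (x ∷ xs) ys g = ≈-trans (⊕-cong ≈-refl (Σl-swap xs ys g)) (≈-sym (Σl-⊕ ys (g x) (λ y → Σl xs (λ x' → g x' y))))

  Σl-filter : ∀ {A : Set} {P : Pred A 0ℓ} (d : Decidable P) (xs : List A) (f : A → Poly) → Σl (filter d xs) f ≈ Σl xs (λ x → indicator (does (d x)) ⊗ f x)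
  Σl-filter d [] f = ≈-refl
  Σl-filter d (x ∷ xs) f with does (d x)
  ... | true = ⊕-cong (≈-sym (⊗-identityˡ (f x))) (Σl-filter d xs f)
  ... | false = Σl-filter d xs f

  ΠF : (n : ℕ) → (Fin n → Poly) → Poly
  ΠF zero f = pone
  ΠF (suc n) f = f zero ⊗ ΠF n (f ∘ suc)

  ΠF-cong : ∀ n {f g : Fin n → Poly} → (∀ k → f k ≈ g k) → ΠF n f ≈ ΠF n g
  ΠF-cong zero h = ≈-refl
  ΠF-cong (suc n) h = ⊗-cong (h zero) (ΠF-cong n (h ∘ suc))

  ΠF-⊗ : ∀ n (f g : Fin n → Poly) → ΠF n f ⊗ ΠF n g ≈ ΠF n (λ k → f k ⊗ g k)
  ΠF-⊗ zero f g = ⊗-identityˡ pone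
  ΠF-⊗ (suc n) f g = ≈-trans (⊗-interchange (f zero) (ΠF n (f ∘ suc)) (g zero) (ΠF n (g ∘ suc))) (⊗-congʳ (f zero ⊗ g zero) (ΠF-⊗ n (f ∘ suc) (g ∘ suc)))

  ΠF-one : ∀ n {f : Fin n → Poly} → (∀ k → f k ≈ pone) → ΠF n f ≈ pone
  ΠF-one zero h = ≈-refl
  ΠF-one (suc n) h = ≈-trans (⊗-cong (h zero) (ΠF-one n (h ∘ suc))) (⊗-identityˡ pone)

  Πl-tab : ∀ {A : Set} n (g : Fin n → A) (f : A → Poly) → Πl (tabulate g) f ≡ ΠF n (f ∘ g)
  Πl-tab zero g f = refl
  Πl-tab (suc n) g f = cong (f (g zero) ⊗_) (Πl-tab n (g ∘ suc) f)

  Πl-++ : ∀ {A : Set} (xs ys : List A) (f : A → Poly) → Πl (xs ++ ys) f ≈ Πl xs f ⊗ Πl ys f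
  Πl-++ [] ys f = ≈-sym (⊗-identityˡ _)
  Πl-++ (x ∷ xs) ys f = ≈-trans (⊗-congʳ (f x) (Πl-++ xs ys f)) (≈-sym (⊗-assoc (f x) _ _))

  Πl-map : ∀ {A B : Set} (g : A → B) (xs : List A) (f : B → Poly) → Πl (map g xs) f ≡ Πl xs (f ∘ g)
  Πl-map g [] f = refl
  Πl-map g (x ∷ xs) f = cong (f (g x) ⊗_) (Πl-map g xs f)

  Πl-concatMap : ∀ {A B : Set} (h : A → List B) (xs : List A) (f : B → Poly) → Πl (concatMap h xs) f ≈ Πl xs (λ x → Πl (h x) f)
  Πl-concatMap h [] f = ≈-refl
  Πl-concatMap h (x ∷ xs) f = ≈-trans (Πl-++ (h x) (concatMap h xs) f) (⊗-congʳ (Πl (h x) f) (Πl-concatMap h xs f))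

  Πl-cong : ∀ {A : Set} (xs : List A) {f g : A → Poly} → (∀ x → f x ≈ g x) → Πl xs f ≈ Πl xs g
  Πl-cong [] h = ≈-refl
  Πl-cong (x ∷ xs) h = ⊗-cong (h x) (Πl-cong xs h)

  module VectorSums (i j : ℕ) where
    Σ-allVecs-ΠF : ∀ {A : Set} n (xs : List A) (F : Fin n → A → Poly) →
      Σl (allVecs i j n xs) (λ v → ΠF n (λ k → F k (Vec.lookup v k))) ≈ ΠF n (λ k → Σl xs (F k))
    Σ-allVecs-ΠF zero xs F = ⊕-identityʳ pone
    Σ-allVecs-ΠF (suc n) xs F = begin
      Σl (concatMap (λ x → map (x Vec.∷_) vecs) xs) Π
        ≈⟨ Σl-concatMap (λ x → map (x Vec.∷_) vecs) xs Π ⟩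
      Σl xs (λ x → Σl (map (x Vec.∷_) vecs) Π)
        ≈⟨ Σl-cong xs (λ {x} _ → ≡⇒≈ (Σl-map (x Vec.∷_) vecs Π)) ⟩
      Σl xs (λ x → Σl vecs (λ v → F zero x ⊗ Πtail v))
        ≈⟨ Σl-cong xs (λ {x} _ → ⊗-Σl (F zero x) vecs Πtail) ⟨
      Σl xs (λ x → F zero x ⊗ Σl vecs Πtail)
        ≈⟨ Σl-cong xs (λ {x} _ → ⊗-congʳ (F zero x) (Σ-allVecs-ΠF n xs (F ∘ suc))) ⟩
      Σl xs (λ x → F zero x ⊗ ΠF n (λ k → Σl xs (F (suc k))))
        ≈⟨ Σl-⊗ _ xs (F zero) ⟨
      Σl xs (F zero) ⊗ ΠF n (λ k → Σl xs (F (suc k))) ∎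
      where
      open ≈-Reasoning
      vecs : List (Vec _ n)
      vecs = allVecs i j n xs
      Π : Vec _ (suc n) → Poly
      Π v = ΠF (suc n) (λ k → F k (Vec.lookup v k))
      Πtail : Vec _ n → Poly
      Πtail v = ΠF n (λ k → F (suc k) (Vec.lookup v k))

module Cones where

  open import Defs
  open RationalFacts
  open import Data.Nat as ℕ using (ℕ; suc)
  open import Data.Rational as ℚ using (ℚ; 0ℚ; 1ℚ; _≤_; _<_; _+_; _*_; 1/_)
  import Data.Nat.Properties as ℕP
  import Data.Rational.Properties as ℚP
  open import Data.Rational.Solver
  open +-*-Solver
  open import Data.List using (List; []; _∷_; length; filter)
  open import Data.List.Relation.Unary.All using (All; []; _∷_)
  open import Data.List.Relation.Unary.Any using (here; there)
  open import Data.List.Membership.Propositional using (_∈_)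
  open import Data.Product using (Σ; _×_; _,_; proj₁; proj₂)
  open import Data.Sum using (inj₁; inj₂)
  open import Data.Empty using (⊥-elim)
  open import Relation.Nullary using (yes; no)
  open import Relation.Binary.PropositionalEquality

  infixl 6 _+ᵥ_
  infixl 7 _·ᵥ_
  _+ᵥ_ : Pt → Pt → Pt
  p +ᵥ q = (proj₁ p + proj₁ q , proj₂ p + proj₂ q)

  _·ᵥ_ : ℚ → Pt → Pt
  m ·ᵥ p = (m * proj₁ p , m * proj₂ p)

  0ᵥ : Pt
  0ᵥ = (0ℚ , 0ℚ)

  -- A non-negative combination of V with total weight c; InConv V q is Cone V q 1ℚ.
  Cone : List Pt → Pt → ℚ → Set
  Cone V q c = Σ (List ℚ) λ ws → (length ws ≡ length V) × All (0ℚ ≤_) ws × (qsum ws ≡ c) × (combo ws V ≡ q)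

  cone-[] : Cone [] 0ᵥ 0ℚ
  cone-[] = [] , refl , [] , refl , refl

  cone-∷ : ∀ {V v m q c} → 0ℚ ≤ m → Cone V q c → Cone (v ∷ V) (m ·ᵥ v +ᵥ q) (m + c)
  cone-∷ {V} {v} {m} p (ws , l , a , s , e) = m ∷ ws , cong suc l , p ∷ a , cong (m +_) s , cong (λ r → m ·ᵥ v +ᵥ r) e

  cone-[]⁻ : ∀ {q c} → Cone [] q c → (q ≡ 0ᵥ) × (c ≡ 0ℚ)
  cone-[]⁻ ([] , l , a , s , e) = sym e , sym s

  record ConeCons (V : List Pt) (v : Pt) (q : Pt) (c : ℚ) : Set where
    constructor coneCons
    field
      m : ℚ
      q' : Pt
      c' : ℚ
      m≥0 : 0ℚ ≤ m
      cone : Cone V q' c'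
      eq : q ≡ m ·ᵥ v +ᵥ q'
      eqc : c ≡ m + c'

  cone-∷⁻ : ∀ {V v q c} → Cone (v ∷ V) q c → ConeCons V v q c
  cone-∷⁻ {V} (m ∷ ws , l , p ∷ a , s , e) = coneCons m (combo ws V) (qsum ws) p (ws , ℕP.suc-injective l , a , refl , refl) (sym e) (sym s)

  cone-subst : ∀ {V q c q' c'} → Cone V q c → q ≡ q' → c ≡ c' → Cone V q' c'
  cone-subst x refl refl = x

  cone-total-nonNeg : ∀ {V q c} → Cone V q c → 0ℚ ≤ c
  cone-total-nonNeg {[]} x = subst (0ℚ ≤_) (sym (proj₂ (cone-[]⁻ x))) ℚP.≤-refl
  cone-total-nonNeg {v ∷ V} x with cone-∷⁻ x
  ... | coneCons m q' c' m≥0 cone eq eqc = subst (0ℚ ≤_) (sym eqc) (nonNeg-+ m≥0 (cone-total-nonNeg cone))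

  0*x+0≡0 : ∀ x → 0ℚ * x + 0ℚ ≡ 0ℚ
  0*x+0≡0 = solve 1 (λ x → con 0ℚ :* x :+ con 0ℚ := con 0ℚ) refl

  cone-0 : ∀ V → Cone V 0ᵥ 0ℚ
  cone-0 [] = cone-[]
  cone-0 (v ∷ V) = cone-subst (cone-∷ {v = v} ℚP.≤-refl (cone-0 V)) (cong₂ _,_ (0*x+0≡0 (proj₁ v)) (0*x+0≡0 (proj₂ v))) (ℚP.+-identityˡ 0ℚ)

  cone-+ : ∀ {V q c q' c'} → Cone V q c → Cone V q' c' → Cone V (q +ᵥ q') (c + c')
  cone-+ {[]} x y with cone-[]⁻ x | cone-[]⁻ y
  ... | refl , refl | refl , refl = cone-subst cone-[] (cong₂ _,_ (ℚP.+-identityˡ 0ℚ) (ℚP.+-identityˡ 0ℚ)) (ℚP.+-identityˡ 0ℚ)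
  cone-+ {v ∷ V} x y with cone-∷⁻ x | cone-∷⁻ y
  ... | coneCons m q1 c1 m≥0 cone eq eqc | coneCons m' q1' c1' m'≥0 cone' eq' eqc' =
    cone-subst (cone-∷ {v = v} (nonNeg-+ m≥0 m'≥0) (cone-+ cone cone'))
      (sym (trans (cong₂ _+ᵥ_ eq eq') (cong₂ _,_ (distrib m m' (proj₁ v) (proj₁ q1) (proj₁ q1')) (distrib m m' (proj₂ v) (proj₂ q1) (proj₂ q1')))))
      (sym (trans (cong₂ _+_ eqc eqc') (regroup m m' c1 c1')))
    where
    distrib : ∀ m m' v a b → (m * v + a) + (m' * v + b) ≡ (m + m') * v + (a + b)
    distrib = solve 5 (λ m m' v a b → (m :* v :+ a) :+ (m' :* v :+ b) := (m :+ m') :* v :+ (a :+ b)) refl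
    regroup : ∀ m m' a b → (m + a) + (m' + b) ≡ (m + m') + (a + b)
    regroup = solve 4 (λ m m' a b → (m :+ a) :+ (m' :+ b) := (m :+ m') :+ (a :+ b)) refl

  cone-· : ∀ {V q c a} → 0ℚ ≤ a → Cone V q c → Cone V (a ·ᵥ q) (a * c)
  cone-· {[]} {a = a} p x with cone-[]⁻ x
  ... | refl , refl = cone-subst cone-[] (cong₂ _,_ (sym (ℚP.*-zeroʳ a)) (sym (ℚP.*-zeroʳ a))) (sym (ℚP.*-zeroʳ a))
  cone-· {v ∷ V} {a = a} p x with cone-∷⁻ x
  ... | coneCons m q1 c1 m≥0 cone eq eqc =
    cone-subst (cone-∷ {v = v} (nonNeg-* p m≥0) (cone-· p cone))
      (sym (trans (cong (a ·ᵥ_) eq) (cong₂ _,_ (distrib a m (proj₁ v) (proj₁ q1)) (distrib a m (proj₂ v) (proj₂ q1)))))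
      (sym (trans (cong (a *_) eqc) (ℚP.*-distribˡ-+ a m c1)))
    where
    distrib : ∀ a m v x → a * (m * v + x) ≡ (a * m) * v + a * x
    distrib = solve 4 (λ a m v x → a :* (m :* v :+ x) := (a :* m) :* v :+ a :* x) refl

  cone-∈ : ∀ {V v} → v ∈ V → Cone V v 1ℚ
  cone-∈ {w ∷ V} (here refl) = cone-subst (cone-∷ {v = w} 0≤1 (cone-0 V)) (cong₂ _,_ (1*x+0≡x (proj₁ w)) (1*x+0≡x (proj₂ w))) (ℚP.+-identityʳ 1ℚ)
    where
    1*x+0≡x : ∀ x → 1ℚ * x + 0ℚ ≡ x
    1*x+0≡x = solve 1 (λ x → con 1ℚ :* x :+ con 0ℚ := x) refl
  cone-∈ {w ∷ V} {v} (there p) = cone-subst (cone-∷ {v = w} ℚP.≤-refl (cone-∈ p)) (cong₂ _,_ (0*x+y≡y (proj₁ w) (proj₁ v)) (0*x+y≡y (proj₂ w) (proj₂ v))) (ℚP.+-identityˡ 1ℚ)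
    where
    0*x+y≡y : ∀ x y → 0ℚ * x + y ≡ y
    0*x+y≡y = solve 2 (λ x y → con 0ℚ :* x :+ y := y) refl

  cone-trans : ∀ {U R q c} → (∀ {u} → u ∈ U → Cone R u 1ℚ) → Cone U q c → Cone R q c
  cone-trans {[]} {R} h x with cone-[]⁻ x
  ... | refl , refl = cone-0 R
  cone-trans {u ∷ U} {R} h x with cone-∷⁻ x
  ... | coneCons m q1 c1 m≥0 cone eq eqc =
    cone-subst (cone-+ (cone-· m≥0 (h (here refl))) (cone-trans (λ p → h (there p)) cone)) (sym eq) (sym (trans eqc (cong (_+ c1) (sym (ℚP.*-identityʳ m)))))

  -- α x + β y + γ, homogenised so that it is linear in (q , c) and hence additive over cones.
  affine : ℚ → ℚ → ℚ → Pt → ℚ → ℚ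
  affine α β γ q c = α * proj₁ q + β * proj₂ q + γ * c

  affine-∷ : ∀ α β γ m v q c → affine α β γ (m ·ᵥ v +ᵥ q) (m + c) ≡ m * affine α β γ v 1ℚ + affine α β γ q c
  affine-∷ α β γ m v q c = expand α β γ m (proj₁ v) (proj₂ v) (proj₁ q) (proj₂ q) c
    where
    expand : ∀ α β γ m v1 v2 q1 q2 c → α * (m * v1 + q1) + β * (m * v2 + q2) + γ * (m + c) ≡ m * (α * v1 + β * v2 + γ * 1ℚ) + (α * q1 + β * q2 + γ * c)
    expand = solve 9 (λ α β γ m v1 v2 q1 q2 c → α :* (m :* v1 :+ q1) :+ β :* (m :* v2 :+ q2) :+ γ :* (m :+ c) := m :* (α :* v1 :+ β :* v2 :+ γ :* con 1ℚ) :+ (α :* q1 :+ β :* q2 :+ γ :* c)) refl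

  affine-0 : ∀ α β γ → affine α β γ 0ᵥ 0ℚ ≡ 0ℚ
  affine-0 α β γ = e α β γ
    where
    e : ∀ α β γ → α * 0ℚ + β * 0ℚ + γ * 0ℚ ≡ 0ℚ
    e = solve 3 (λ α β γ → α :* con 0ℚ :+ β :* con 0ℚ :+ γ :* con 0ℚ := con 0ℚ) refl

  affine-nonNeg : ∀ α β γ {V q c} → (∀ {v} → v ∈ V → 0ℚ ≤ affine α β γ v 1ℚ) → Cone V q c → 0ℚ ≤ affine α β γ q c
  affine-nonNeg α β γ {[]} h x with cone-[]⁻ x
  ... | refl , refl = subst (0ℚ ≤_) (sym (affine-0 α β γ)) ℚP.≤-refl
  affine-nonNeg α β γ {v ∷ V} h x with cone-∷⁻ x
  ... | coneCons m q1 c1 m≥0 cone refl refl = subst (0ℚ ≤_) (sym (affine-∷ α β γ m v q1 c1)) (nonNeg-+ (nonNeg-* m≥0 (h (here refl))) (affine-nonNeg α β γ (λ p → h (there p)) cone))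

  face : ℚ → ℚ → ℚ → List Pt → List Pt
  face α β γ V = filter (λ v → affine α β γ v 1ℚ ℚP.≟ 0ℚ) V

  affine-∷-vanishes : ∀ α β γ {v V q c m} → (∀ {u} → u ∈ v ∷ V → 0ℚ ≤ affine α β γ u 1ℚ) →
    0ℚ ≤ m → Cone V q c → affine α β γ (m ·ᵥ v +ᵥ q) (m + c) ≡ 0ℚ →
    (m * affine α β γ v 1ℚ ≡ 0ℚ) × (affine α β γ q c ≡ 0ℚ)
  affine-∷-vanishes α β γ {v} {V} {q} {c} {m} h m≥0 cone z =
    p+q≡0⇒p≡0 head≥0 tail≥0 sum≡0 , p+q≡0⇒p≡0 tail≥0 head≥0 (trans (ℚP.+-comm (affine α β γ q c) (m * affine α β γ v 1ℚ)) sum≡0)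
    where
    head≥0 : 0ℚ ≤ m * affine α β γ v 1ℚ
    head≥0 = nonNeg-* m≥0 (h (here refl))
    tail≥0 : 0ℚ ≤ affine α β γ q c
    tail≥0 = affine-nonNeg α β γ (λ p → h (there p)) cone
    sum≡0 : m * affine α β γ v 1ℚ + affine α β γ q c ≡ 0ℚ
    sum≡0 = trans (sym (affine-∷ α β γ m v q c)) z

  cone-face : ∀ α β γ {V q c} → (∀ {v} → v ∈ V → 0ℚ ≤ affine α β γ v 1ℚ) → Cone V q c → affine α β γ q c ≡ 0ℚ → Cone (face α β γ V) q c
  cone-face α β γ {[]} h x z = x
  cone-face α β γ {v ∷ V} h x z with cone-∷⁻ x
  ... | coneCons m q₁ c₁ m≥0 cone refl refl with affine α β γ v 1ℚ ℚP.≟ 0ℚ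
  ...   | yes _  = cone-∷ m≥0 (cone-face α β γ (λ p → h (there p)) cone (proj₂ (affine-∷-vanishes α β γ h m≥0 cone z)))
  ...   | no v≢0 =
    cone-subst (cone-face α β γ (λ p → h (there p)) cone (proj₂ (affine-∷-vanishes α β γ h m≥0 cone z)))
      (sym (cong₂ _,_ (0·a+b≡b (proj₁ v) (proj₁ q₁)) (0·a+b≡b (proj₂ v) (proj₂ q₁))))
      (sym (trans (cong (_+ c₁) m≡0) (ℚP.+-identityˡ c₁)))
    where
    m≡0 : m ≡ 0ℚ
    m≡0 = p*q≡0⇒p≡0 (proj₁ (affine-∷-vanishes α β γ h m≥0 cone z)) v≢0
    0·a+b≡b : ∀ a b → m * a + b ≡ b
    0·a+b≡b a b = trans (cong (λ t → t * a + b) m≡0) (trans (cong (_+ b) (ℚP.*-zeroˡ a)) (ℚP.+-identityˡ b))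

  face-empty : ∀ α β γ {V} → (∀ {v} → v ∈ V → 0ℚ < affine α β γ v 1ℚ) → face α β γ V ≡ []
  face-empty α β γ {[]} h = refl
  face-empty α β γ {v ∷ V} h with affine α β γ v 1ℚ ℚP.≟ 0ℚ
  ... | yes p = ⊥-elim (ℚP.<-irrefl (sym p) (h (here refl)))
  ... | no np = face-empty α β γ (λ p → h (there p))

  affine-pos : ∀ α β γ {V q c} → (∀ {v} → v ∈ V → 0ℚ < affine α β γ v 1ℚ) → Cone V q c → 0ℚ < c → 0ℚ < affine α β γ q c
  affine-pos α β γ {V} {q} {c} h x c>0 with 0≤p⇒p≡0⊎0<p (affine-nonNeg α β γ (λ p → ℚP.<⇒≤ (h p)) x)
  ... | inj₂ p = p
  ... | inj₁ z = ⊥-elim (ℚP.<-irrefl (sym (proj₂ (cone-[]⁻ (subst (λ W → Cone W q c) (face-empty α β γ h) (cone-face α β γ (λ p → ℚP.<⇒≤ (h p)) x z))))) c>0)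

  cone-total-0⇒0 : ∀ {V q} → Cone V q 0ℚ → q ≡ 0ᵥ
  cone-total-0⇒0 {[]} x = proj₁ (cone-[]⁻ x)
  cone-total-0⇒0 {v ∷ V} x with cone-∷⁻ x
  ... | coneCons m q1 c1 m≥0 cone refl eqc = trans (cong (λ t → t ·ᵥ v +ᵥ q1) m0) (trans (cong (λ t → 0ℚ ·ᵥ v +ᵥ t) (cone-total-0⇒0 (cone-subst cone refl c0))) (cong₂ _,_ (0*x+0≡0 (proj₁ v)) (0*x+0≡0 (proj₂ v))))
    where
    m0 : m ≡ 0ℚ
    m0 = p+q≡0⇒p≡0 m≥0 (cone-total-nonNeg cone) (sym eqc)
    c0 : c1 ≡ 0ℚ
    c0 = p+q≡0⇒p≡0 (cone-total-nonNeg cone) m≥0 (trans (ℚP.+-comm c1 m) (sym eqc))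

  cone-normalise : ∀ {V w c} → Cone V (c ·ᵥ w) c → 0ℚ < c → Cone V w 1ℚ
  cone-normalise {V} {w} {c} x c>0 = cone-subst (cone-· (ℚP.<⇒≤ (ℚP.positive⁻¹ (1/ c))) x) (cong₂ _,_ (c⁻¹*[c*x]≡x (proj₁ w)) (c⁻¹*[c*x]≡x (proj₂ w))) (ℚP.*-inverseˡ c)
    where
    instance
      c-positive : ℚ.Positive c
      c-positive = ℚ.positive c>0
      c-nonZero : ℚ.NonZero c
      c-nonZero = ℚP.pos⇒nonZero c
      c⁻¹-positive : ℚ.Positive (1/ c)
      c⁻¹-positive = ℚP.1/pos⇒pos c
    c⁻¹*[c*x]≡x : ∀ x → (1/ c) * (c * x) ≡ x
    c⁻¹*[c*x]≡x x = trans (sym (ℚP.*-assoc (1/ c) c x)) (trans (cong (_* x) (ℚP.*-inverseˡ c)) (ℚP.*-identityˡ x))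

module ExtremePoints where

  open import Defs
  open RationalFacts
  open Cones
  open import Data.Nat as ℕ using (ℕ; zero; suc)
  import Data.Nat.Properties as ℕP
  open import Data.Integer using (+_)
  open import Data.Rational as ℚ using (ℚ; 0ℚ; 1ℚ; _≤_; _<_; _+_; _*_; _-_; -_)
  import Data.Rational.Properties as ℚP
  open import Data.Rational.Solver
  open +-*-Solver
  open import Data.List using (List; []; _∷_; length; filter)
  open import Data.List.Properties using (filter-notAll)
  open import Data.List.Relation.Unary.All using ([]; _∷_)
  open import Data.List.Relation.Unary.Any using (here; there; any?)
  open import Data.List.Membership.Propositional using (_∈_; find; lose)
  open import Data.List.Membership.Propositional.Properties using (∈-filter⁺; ∈-filter⁻)
  open import Data.Product using (Σ; _×_; _,_; proj₁; proj₂)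
  open import Data.Product.Properties using (≡-dec)
  open import Data.Sum using (inj₁; inj₂)
  open import Data.Empty using (⊥; ⊥-elim)
  open import Relation.Nullary using (¬_; yes; no; Dec; ¬?)
  open import Relation.Binary.PropositionalEquality

  -- Rewriting each point of U through w ∷ R; the coefficient of w stays below the total
  -- weight because no point of U equals w.
  record PeeledOff (w : Pt) (R : List Pt) (q : Pt) (c : ℚ) : Set where
    constructor peeledOff
    field
      Λ : ℚ
      r : Pt
      eq : q ≡ Λ ·ᵥ w +ᵥ r
      cone : Cone R r (c - Λ)
      Λ≥0 : 0ℚ ≤ Λ
      Λ≤c : Λ ≤ c
      strict : 0ℚ < c → Λ < c

  peel-off : ∀ {w R U q c} → (∀ {u} → u ∈ U → u ≢ w × Cone (w ∷ R) u 1ℚ) → Cone U q c → PeeledOff w R q c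
  peel-off {w} {R} {[]} h x with cone-[]⁻ x
  ... | refl , refl = peeledOff 0ℚ 0ᵥ (cong₂ _,_ (sym (0*x+0≡0 (proj₁ w))) (sym (0*x+0≡0 (proj₂ w)))) (cone-subst (cone-0 R) refl (sym (ℚP.+-inverseʳ 0ℚ))) ℚP.≤-refl ℚP.≤-refl (λ p → ⊥-elim (ℚP.<-irrefl refl p))
  peel-off {w} {R} {u ∷ U} h x with cone-∷⁻ x
  ... | coneCons m q1 c1 m≥0 cone refl refl with peel-off (λ p → h (there p)) cone | h (here refl)
  ... | peeledOff Λ' r' eq' cone' Λ'≥0 Λ'≤c' Λ<c' | u≢w , cu with cone-∷⁻ cu
  ... | coneCons l ru cu' l≥0 coneu equ eqc1 =
    peeledOff (m * l + Λ') (m ·ᵥ ru +ᵥ r') split cone-rest (nonNeg-+ (nonNeg-* m≥0 l≥0) Λ'≥0) ml+Λ≤m+c strict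
    where
    c≡1-l : cu' ≡ 1ℚ - l
    c≡1-l = trans (b≡[a+b]-a l cu') (cong (_- l) (sym eqc1))
      where
      b≡[a+b]-a : ∀ a b → b ≡ (a + b) - a
      b≡[a+b]-a = solve 2 (λ a b → b := (a :+ b) :- a) refl
    l≤1 : l ≤ 1ℚ
    l≤1 = subst₂ _≤_ (ℚP.+-identityʳ l) (sym eqc1) (ℚP.+-monoʳ-≤ l (cone-total-nonNeg coneu))
    l≢1 : l ≢ 1ℚ
    l≢1 e = u≢w (trans equ (trans (cong₂ (λ a b → a ·ᵥ w +ᵥ b) e (cone-total-0⇒0 (cone-subst coneu refl c≡0))) (cong₂ _,_ (1*x+0≡x (proj₁ w)) (1*x+0≡x (proj₂ w)))))
      where
      c≡0 : cu' ≡ 0ℚ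
      c≡0 = trans c≡1-l (trans (cong (λ t → 1ℚ - t) e) (ℚP.+-inverseʳ 1ℚ))
      1*x+0≡x : ∀ x → 1ℚ * x + 0ℚ ≡ x
      1*x+0≡x = solve 1 (λ x → con 1ℚ :* x :+ con 0ℚ := x) refl
    l<1 : l < 1ℚ
    l<1 = ≤∧≢⇒< l≤1 l≢1
    split : m ·ᵥ u +ᵥ q1 ≡ (m * l + Λ') ·ᵥ w +ᵥ (m ·ᵥ ru +ᵥ r')
    split = trans (cong₂ (λ a b → m ·ᵥ a +ᵥ b) equ eq') (cong₂ _,_ (regroup m l Λ' (proj₁ w) (proj₁ ru) (proj₁ r')) (regroup m l Λ' (proj₂ w) (proj₂ ru) (proj₂ r')))
      where
      regroup : ∀ m l L w r s → m * (l * w + r) + (L * w + s) ≡ (m * l + L) * w + (m * r + s)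
      regroup = solve 6 (λ m l L w r s → m :* (l :* w :+ r) :+ (L :* w :+ s) := (m :* l :+ L) :* w :+ (m :* r :+ s)) refl
    cone-rest : Cone R (m ·ᵥ ru +ᵥ r') ((m + c1) - (m * l + Λ'))
    cone-rest = cone-subst (cone-+ (cone-· m≥0 coneu) cone') refl (trans (cong (λ t → m * t + (c1 - Λ')) c≡1-l) (regroup m l c1 Λ'))
      where
      regroup : ∀ m l c L → m * (1ℚ - l) + (c - L) ≡ (m + c) - (m * l + L)
      regroup = solve 4 (λ m l c L → m :* (con 1ℚ :- l) :+ (c :- L) := (m :+ c) :- (m :* l :+ L)) refl
    ml≤m : m * l ≤ m
    ml≤m = subst (m * l ≤_) (ℚP.*-identityʳ m) (ℚP.*-monoˡ-≤-nonNeg m {{ℚ.nonNegative m≥0}} l≤1)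
    ml+Λ≤m+c : m * l + Λ' ≤ m + c1
    ml+Λ≤m+c = ℚP.+-mono-≤ ml≤m Λ'≤c'
    strict : 0ℚ < m + c1 → m * l + Λ' < m + c1
    strict p with 0≤p⇒p≡0⊎0<p m≥0
    ... | inj₁ m0 = ℚP.+-mono-≤-< ml≤m (Λ<c' (subst (λ t → 0ℚ < t) (trans (cong (_+ c1) m0) (ℚP.+-identityˡ c1)) p))
    ... | inj₂ mp = ℚP.+-mono-<-≤ (subst (m * l <_) (ℚP.*-identityʳ m) (ℚP.*-monoʳ-<-pos m {{ℚ.positive mp}} l<1)) Λ'≤c'

  -- w = Λ w + r with Λ < 1 gives r = (1 - Λ) w, so w is already in the hull of R.
  extreme-point : ∀ {w R U} → ¬ (w ∈ U) → Cone U w 1ℚ → (∀ {u} → u ∈ U → Cone (w ∷ R) u 1ℚ) → Cone R w 1ℚ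
  extreme-point {w} {R} {U} w∉U x h with peel-off {w} {R} {U} (λ {u} p → (λ e → w∉U (subst (_∈ U) e p)) , h p) x
  ... | peeledOff Λ r eq cone _ _ st = cone-normalise (cone-subst cone (cong₂ _,_ (k (proj₁ w) (proj₁ r) (cong proj₁ eq)) (k (proj₂ w) (proj₂ r) (cong proj₂ eq))) refl) (p<q⇒0<q-p (st 0<1))
    where
    r≡[w-Λw] : ∀ L w r → r ≡ (L * w + r) - L * w
    r≡[w-Λw] = solve 3 (λ L w r → r := (L :* w :+ r) :- L :* w) refl
    w-Lw≡[1-L]w : ∀ L w → w - L * w ≡ (1ℚ - L) * w
    w-Lw≡[1-L]w = solve 2 (λ L w → w :- L :* w := (con 1ℚ :- L) :* w) refl
    k : ∀ w₁ r₁ → w₁ ≡ Λ * w₁ + r₁ → r₁ ≡ (1ℚ - Λ) * w₁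
    k w₁ r₁ e = trans (r≡[w-Λw] Λ w₁ r₁) (trans (cong (λ t → t - Λ * w₁) (sym e)) (w-Lw≡[1-L]w Λ w₁))

  infix 4 _≟ₚ_
  _≟ₚ_ : (p q : Pt) → Dec (p ≡ q)
  _≟ₚ_ = ≡-dec ℚP._≟_ ℚP._≟_

  remove : Pt → List Pt → List Pt
  remove x V = filter (λ y → ¬? (y ≟ₚ x)) V

  ∈-remove⁺ : ∀ {x y V} → y ∈ V → ¬ (y ≡ x) → y ∈ remove x V
  ∈-remove⁺ {x} y∈V n = ∈-filter⁺ (λ y → ¬? (y ≟ₚ x)) y∈V n

  ∈-remove⁻ : ∀ {x y V} → y ∈ remove x V → (y ∈ V) × ¬ (y ≡ x)
  ∈-remove⁻ {x} p = ∈-filter⁻ (λ y → ¬? (y ≟ₚ x)) p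

  ConvexPosition∈ : List Pt → Set
  ConvexPosition∈ V = ∀ {x} → x ∈ V → ¬ Cone (remove x V) x 1ℚ

  cone-∷-remove : ∀ {x V y} → y ∈ V → Cone (x ∷ remove x V) y 1ℚ
  cone-∷-remove {x} {V} {y} y∈V with y ≟ₚ x
  ... | yes refl = cone-∈ (here refl)
  ... | no n = cone-∈ (there (∈-remove⁺ y∈V n))

  open import Data.List.Membership.DecPropositional _≟ₚ_ using (_∈?_)

  convexPosition-⊆ : ∀ {V V'} → ConvexPosition∈ V → (∀ {x} → x ∈ V → Cone V' x 1ℚ) → (∀ {x} → x ∈ V' → Cone V x 1ℚ) → ∀ {x} → x ∈ V → x ∈ V'
  convexPosition-⊆ {V} {V'} convex h h' {x} x∈V with x ∈? V'
  ... | yes p = p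
  ... | no np = ⊥-elim (convex x∈V (extreme-point np (h x∈V) (λ {u} u∈V' → cone-trans (λ {y} y∈V → cone-∷-remove y∈V) (h' u∈V'))))

  module Pruning (decConv : (V : List Pt) (q : Pt) → Dec (InConv V q)) where

    record SpanningSubset (L : List Pt) : Set where
      constructor spanningSubset
      field
        pts : List Pt
        pts⊆ : ∀ {y} → y ∈ pts → y ∈ L
        spans : ∀ {y} → y ∈ L → Cone pts y 1ℚ
        convex : ConvexPosition∈ pts

    prune : ∀ {L} (n : ℕ) (R : List Pt) → length R ℕ.≤ n → (∀ {y} → y ∈ R → y ∈ L) → (∀ {y} → y ∈ L → Cone R y 1ℚ) → SpanningSubset L
    prune {L} n R len sb cv with any? (λ x → decConv (remove x R) x) R
    ... | no na = spanningSubset R sb cv (λ {x} x∈R c → na (lose x∈R c))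
    ... | yes a with find a
    ... | x , x∈R , px with n
    ...   | zero = ⊥-elim (emp len x∈R)
      where
      emp : ∀ {R : List Pt} → length R ℕ.≤ 0 → x ∈ R → ⊥
      emp {[]} _ ()
      emp {_ ∷ _} () _
    ...   | suc n' = prune n' (remove x R) len' (λ p → sb (proj₁ (∈-remove⁻ p))) (λ {y} y∈L → cone-trans step (cv y∈L))
      where
      len' : length (remove x R) ℕ.≤ n'
      len' = ℕP.≤-pred (ℕP.≤-trans (filter-notAll (λ y → ¬? (y ≟ₚ x)) R (lose x∈R (λ z → z refl))) len)
      step : ∀ {z} → z ∈ R → Cone (remove x R) z 1ℚ
      step {z} z∈R with z ≟ₚ x
      ... | yes refl = px
      ... | no nz = cone-∈ (∈-remove⁺ z∈R nz)

    spanningConvexSubset : (L : List Pt) → SpanningSubset L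
    spanningConvexSubset L = prune (length L) L ℕP.≤-refl (λ p → p) cone-∈

module Triangle where

  open import Defs
  open RationalFacts
  open Cones
  open ExtremePoints
  open import Data.Nat as ℕ using (ℕ)
  open import Data.Integer as ℤ using (+_)
  import Data.Integer.Properties as ℤP
  open import Data.Rational as ℚ using (ℚ; 0ℚ; 1ℚ; mkℚ; _≤_; _<_; _+_; _*_; _-_; -_)
  import Data.Rational.Properties as ℚP
  import Data.Nat.Coprimality as Cop
  open import Data.Rational.Solver
  open +-*-Solver
  open import Data.List using (List; []; _∷_)
  open import Data.Product using (_×_; _,_; proj₁; proj₂)
  open import Data.Sum using (_⊎_; inj₁; inj₂)
  open import Relation.Nullary using (¬_)
  open import Relation.Binary.PropositionalEquality hiding (J)

  ℕtoℚ≡mkℚ : ∀ a → ℕtoℚ a ≡ mkℚ (+ a) 0 (Cop.sym (Cop.1-coprimeTo a))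
  ℕtoℚ≡mkℚ a = ℚP.normalize-coprime (Cop.sym (Cop.1-coprimeTo a))

  ℕtoℚ-injective : ∀ {a b} → ℕtoℚ a ≡ ℕtoℚ b → a ≡ b
  ℕtoℚ-injective {a} {b} e = ℤP.+-injective (cong ℚ.↥_ (trans (sym (ℕtoℚ≡mkℚ a)) (trans e (ℕtoℚ≡mkℚ b))))

  ℕtoℚ-pos : ∀ {a} → 1 ℕ.≤ a → 0ℚ < ℕtoℚ a
  ℕtoℚ-pos {a} p = subst (0ℚ <_) (sym (ℕtoℚ≡mkℚ a)) (ℚ.*<* (subst (ℤ._<_ (+ 0)) (sym (ℤP.*-identityʳ (+ a))) (ℤ.+<+ p)))

  latt-injective : ∀ {a b a' b'} → latt a b ≡ latt a' b' → (a ≡ a') × (b ≡ b')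
  latt-injective e = ℕtoℚ-injective (cong proj₁ e) , ℕtoℚ-injective (cong proj₂ e)

  module Geometry (i j : ℕ) (i≥1 : 1 ℕ.≤ i) (j≥1 : 1 ℕ.≤ j) where
    I J : ℚ
    I = ℕtoℚ i
    J = ℕtoℚ j

    I>0 : 0ℚ < I
    I>0 = ℕtoℚ-pos i≥1
    J>0 : 0ℚ < J
    J>0 = ℕtoℚ-pos j≥1

    O C : Pt
    O = origin i j
    C = corner i j

    O≢C : ¬ (O ≡ C)
    O≢C e = ℚP.<-irrefl (cong proj₁ e) I>0

    Interior : Pt → Set
    Interior = IntΔ i j

    -- Δ is cut out by the (homogenised) functionals y, i - x and j x - i y; the functional x
    -- separates O from the other admissible vertices.
    affine-y : ∀ q → affine 0ℚ 1ℚ 0ℚ q 1ℚ ≡ proj₂ q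
    affine-y q = e (proj₁ q) (proj₂ q)
      where
      e : ∀ x y → 0ℚ * x + 1ℚ * y + 0ℚ * 1ℚ ≡ y
      e = solve 2 (λ x y → con 0ℚ :* x :+ con 1ℚ :* y :+ con 0ℚ :* con 1ℚ := y) refl
    affine-x : ∀ q → affine 1ℚ 0ℚ 0ℚ q 1ℚ ≡ proj₁ q
    affine-x q = e (proj₁ q) (proj₂ q)
      where
      e : ∀ x y → 1ℚ * x + 0ℚ * y + 0ℚ * 1ℚ ≡ x
      e = solve 2 (λ x y → con 1ℚ :* x :+ con 0ℚ :* y :+ con 0ℚ :* con 1ℚ := x) refl
    affine-right : ∀ q → affine (- 1ℚ) 0ℚ I q 1ℚ ≡ I - proj₁ q
    affine-right q = e I (proj₁ q) (proj₂ q)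
      where
      e : ∀ I x y → (- 1ℚ) * x + 0ℚ * y + I * 1ℚ ≡ I - x
      e = solve 3 (λ I x y → (:- con 1ℚ) :* x :+ con 0ℚ :* y :+ I :* con 1ℚ := I :- x) refl
    affine-diag : ∀ q → affine J (- I) 0ℚ q 1ℚ ≡ J * proj₁ q - proj₂ q * I
    affine-diag q = e I J (proj₁ q) (proj₂ q)
      where
      e : ∀ I J x y → J * x + (- I) * y + 0ℚ * 1ℚ ≡ J * x - y * I
      e = solve 4 (λ I J x y → J :* x :+ (:- I) :* y :+ con 0ℚ :* con 1ℚ := J :* x :- y :* I) refl

    interior-y : ∀ {v} → Interior v → 0ℚ < affine 0ℚ 1ℚ 0ℚ v 1ℚ
    interior-y {v} (a , b , c) = subst (0ℚ <_) (sym (affine-y v)) a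
    interior-right : ∀ {v} → Interior v → 0ℚ < affine (- 1ℚ) 0ℚ I v 1ℚ
    interior-right {v} (a , b , c) = subst (0ℚ <_) (sym (affine-right v)) (p<q⇒0<q-p b)
    interior-diag : ∀ {v} → Interior v → 0ℚ < affine J (- I) 0ℚ v 1ℚ
    interior-diag {v} (a , b , c) = subst (0ℚ <_) (sym (affine-diag v)) (p<q⇒0<q-p c)
    interior-x : ∀ {v} → Interior v → 0ℚ < affine 1ℚ 0ℚ 0ℚ v 1ℚ
    interior-x {v} (a , b , c) = subst (0ℚ <_) (sym (affine-x v)) (ℚP.*-cancelˡ-<-nonNeg J {{ℚ.nonNegative (ℚP.<⇒≤ J>0)}} (subst (_< J * proj₁ v) (sym (ℚP.*-zeroʳ J)) (ℚP.<-trans (pos-* a I>0) c)))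

    O-y : affine 0ℚ 1ℚ 0ℚ O 1ℚ ≡ 0ℚ
    O-y = affine-y O
    O-x : affine 1ℚ 0ℚ 0ℚ O 1ℚ ≡ 0ℚ
    O-x = affine-x O
    O-r : 0ℚ < affine (- 1ℚ) 0ℚ I O 1ℚ
    O-r = subst (0ℚ <_) (sym (trans (affine-right O) (ℚP.+-identityʳ I))) I>0
    O-h : affine J (- I) 0ℚ O 1ℚ ≡ 0ℚ
    O-h = trans (affine-diag O) (e I J)
      where
      e : ∀ I J → J * 0ℚ - 0ℚ * I ≡ 0ℚ
      e = solve 2 (λ I J → J :* con 0ℚ :- con 0ℚ :* I := con 0ℚ) refl
    C-y : 0ℚ < affine 0ℚ 1ℚ 0ℚ C 1ℚ
    C-y = subst (0ℚ <_) (sym (affine-y C)) J>0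
    C-x : 0ℚ < affine 1ℚ 0ℚ 0ℚ C 1ℚ
    C-x = subst (0ℚ <_) (sym (affine-x C)) I>0
    C-r : affine (- 1ℚ) 0ℚ I C 1ℚ ≡ 0ℚ
    C-r = trans (affine-right C) (ℚP.+-inverseʳ I)
    C-h : affine J (- I) 0ℚ C 1ℚ ≡ 0ℚ
    C-h = trans (affine-diag C) (e I J)
      where
      e : ∀ I J → J * I - J * I ≡ 0ℚ
      e = solve 2 (λ I J → J :* I :- J :* I := con 0ℚ) refl

    O-not-interior : ¬ Interior O
    O-not-interior (a , _ , _) = ℚP.<-irrefl refl a
    C-not-interior : ¬ Interior C
    C-not-interior (_ , b , _) = ℚP.<-irrefl refl b

    -- The possible vertices of a member of C.
    Allowed : Pt → Set
    Allowed v = (v ≡ O) ⊎ (v ≡ C) ⊎ Interior v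

    allowed-y : ∀ {v} → Allowed v → 0ℚ ≤ affine 0ℚ 1ℚ 0ℚ v 1ℚ
    allowed-y (inj₁ refl) = ℚP.≤-reflexive (sym O-y)
    allowed-y (inj₂ (inj₁ refl)) = ℚP.<⇒≤ C-y
    allowed-y (inj₂ (inj₂ t)) = ℚP.<⇒≤ (interior-y t)
    allowed-right : ∀ {v} → Allowed v → 0ℚ ≤ affine (- 1ℚ) 0ℚ I v 1ℚ
    allowed-right (inj₁ refl) = ℚP.<⇒≤ O-r
    allowed-right (inj₂ (inj₁ refl)) = ℚP.≤-reflexive (sym C-r)
    allowed-right (inj₂ (inj₂ t)) = ℚP.<⇒≤ (interior-right t)
    allowed-diag : ∀ {v} → Allowed v → 0ℚ ≤ affine J (- I) 0ℚ v 1ℚ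
    allowed-diag (inj₁ refl) = ℚP.≤-reflexive (sym O-h)
    allowed-diag (inj₂ (inj₁ refl)) = ℚP.≤-reflexive (sym C-h)
    allowed-diag (inj₂ (inj₂ t)) = ℚP.<⇒≤ (interior-diag t)

    toInΔ : ∀ {q} → 0ℚ ≤ affine 0ℚ 1ℚ 0ℚ q 1ℚ → 0ℚ ≤ affine (- 1ℚ) 0ℚ I q 1ℚ → 0ℚ ≤ affine J (- I) 0ℚ q 1ℚ → InΔ i j q
    toInΔ {q} a b c = subst (0ℚ ≤_) (affine-y q) a , 0≤q-p⇒p≤q (subst (0ℚ ≤_) (affine-right q) b) , 0≤q-p⇒p≤q (subst (0ℚ ≤_) (affine-diag q) c)

    InΔ⇒0≤x : ∀ {q} → InΔ i j q → 0ℚ ≤ proj₁ q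
    InΔ⇒0≤x {q} (a , b , c) = ℚP.*-cancelˡ-≤-pos J {{ℚ.positive J>0}} (subst (_≤ J * proj₁ q) (sym (ℚP.*-zeroʳ J)) (ℚP.≤-trans (nonNeg-* a (ℚP.<⇒≤ I>0)) c))

    -- On the diagonal, i · q = (i - x) · O + x · C.
    diagonal⇒∈OC : ∀ {q} → InΔ i j q → proj₂ q * I ≡ J * proj₁ q → InConv (O ∷ C ∷ []) q
    diagonal⇒∈OC {q} d@(a , b , c) e = cone-normalise (cone-subst (cone-∷ {v = O} (p≤q⇒0≤q-p b) (cone-∷ {v = C} (InΔ⇒0≤x d) cone-[])) (cong₂ _,_ (x-coord I J (proj₁ q)) (trans (y-coord I J (proj₁ q)) (trans (ℚP.*-comm (proj₁ q) J) (trans (sym e) (ℚP.*-comm (proj₂ q) I))))) (total I (proj₁ q))) I>0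
      where
      x-coord : ∀ I J x → (I - x) * 0ℚ + (x * I + 0ℚ) ≡ I * x
      x-coord = solve 3 (λ I J x → (I :- x) :* con 0ℚ :+ (x :* I :+ con 0ℚ) := I :* x) refl
      y-coord : ∀ I J x → (I - x) * 0ℚ + (x * J + 0ℚ) ≡ x * J
      y-coord = solve 3 (λ I J x → (I :- x) :* con 0ℚ :+ (x :* J :+ con 0ℚ) := x :* J) refl
      total : ∀ I x → (I - x) + (x + 0ℚ) ≡ I
      total = solve 2 (λ I x → (I :- x) :+ (x :+ con 0ℚ) := I) refl

module GridCells where

  open import Defs
  open RationalFacts
  open Cones
  open ExtremePoints
  open Triangle
  open import Data.Nat using (ℕ; zero; suc)
  open import Data.Bool using (Bool; true; T?)
  open import Data.Bool.Properties using (T-≡)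
  open import Data.Fin as Fin using (Fin; zero; suc)
  import Data.Fin.Properties as FinP
  open import Data.Rational using (1ℚ)
  open import Data.List using (List; []; _∷_; map; filterᵇ; concatMap; allFin; removeAt; lookup; cartesianProduct; _++_)
  open import Data.List.Relation.Unary.Any as Any using (Any; here; there)
  import Data.List.Relation.Unary.Any.Properties as AnyP
  open import Data.List.Relation.Unary.All as All using (All; []; _∷_)
  open import Data.List.Relation.Unary.AllPairs using ([]; _∷_)
  open import Data.List.Relation.Unary.Unique.Propositional using (Unique)
  import Data.List.Relation.Unary.Unique.Propositional.Properties as UP
  open import Data.List.Membership.Propositional using (_∈_)
  open import Data.List.Membership.Propositional.Properties using (∈-filter⁺; ∈-filter⁻; ∈-map⁺; ∈-map⁻; ∈-allFin; ∈-lookup; ∈-cartesianProductWith⁺)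
  open import Data.Vec as Vec using (Vec)
  import Data.Vec.Properties as VecP
  open import Data.Product using (Σ; _×_; _,_; proj₁; proj₂)
  open import Data.Empty using (⊥-elim)
  open import Relation.Nullary using (¬_)
  open import Relation.Binary.PropositionalEquality
  open import Function using (_∘_; Equivalence)

  module Cells (i j : ℕ) where
    Cell : Set
    Cell = Fin (suc i) × Fin (suc j)

    bit : Grid i j → Cell → Bool
    bit G pt = Vec.lookup (Vec.lookup G (proj₁ pt)) (proj₂ pt)

    point : Cell → Pt
    point = toPt i j

    point-injective : ∀ {p q} → point p ≡ point q → p ≡ q
    point-injective {a , b} {a' , b'} e with latt-injective e
    ... | e1 , e2 = cong₂ _,_ (FinP.toℕ-injective e1) (FinP.toℕ-injective e2)

    gridPts≡cartesianProduct : ∀ {m n} (xs : List (Fin m)) (ys : List (Fin n)) → concatMap (λ a → map (λ b → a , b) ys) xs ≡ cartesianProduct xs ys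
    gridPts≡cartesianProduct [] ys = refl
    gridPts≡cartesianProduct (x ∷ xs) ys = cong (map (λ b → x , b) ys ++_) (gridPts≡cartesianProduct xs ys)

    gridPts-unique : Unique (gridPts i j)
    gridPts-unique = subst Unique (sym (gridPts≡cartesianProduct (allFin (suc i)) (allFin (suc j)))) (UP.cartesianProduct⁺ (UP.allFin⁺ (suc i)) (UP.allFin⁺ (suc j)))

    gridPts-complete : ∀ pt → pt ∈ gridPts i j
    gridPts-complete (a , b) = subst ((a , b) ∈_) (sym (gridPts≡cartesianProduct (allFin (suc i)) (allFin (suc j)))) (∈-cartesianProductWith⁺ _,_ (∈-allFin a) (∈-allFin b))

    V : Grid i j → List Pt
    V G = vertices i j G

    selectedCells : Grid i j → List Cell
    selectedCells G = filterᵇ (bit G) (gridPts i j)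

    vertices-unique : ∀ G → Unique (V G)
    vertices-unique G = UP.map⁺ point-injective (UP.filter⁺ (T? ∘ bit G) gridPts-unique)

    bit⇒∈vertices : ∀ G pt → bit G pt ≡ true → point pt ∈ V G
    bit⇒∈vertices G pt e = ∈-map⁺ point (∈-filter⁺ (T? ∘ bit G) (gridPts-complete pt) (Equivalence.from T-≡ e))

    ∈vertices⇒cell : ∀ G {y} → y ∈ V G → Σ Cell λ pt → (y ≡ point pt) × (bit G pt ≡ true)
    ∈vertices⇒cell G p with ∈-map⁻ point p
    ... | pt , q , e = pt , e , Equivalence.to T-≡ (proj₂ (∈-filter⁻ (T? ∘ bit G) q))

    ∈vertices⇒bit : ∀ G pt → point pt ∈ V G → bit G pt ≡ true
    ∈vertices⇒bit G pt p with ∈vertices⇒cell G p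
    ... | pt' , e , b = subst (λ z → bit G z ≡ true) (sym (point-injective e)) b

    grid-ext : ∀ {G H : Grid i j} → (∀ pt → bit G pt ≡ bit H pt) → G ≡ H
    grid-ext {G} {H} h = trans (sym (VecP.tabulate∘lookup G)) (trans (VecP.tabulate-cong (λ a → trans (sym (VecP.tabulate∘lookup (Vec.lookup G a))) (trans (VecP.tabulate-cong (λ b → h (a , b))) (VecP.tabulate∘lookup (Vec.lookup H a))))) (VecP.tabulate∘lookup H))

  ∈-removeAt⁺ : ∀ {A : Set} (xs : List A) k {y} → y ∈ xs → ¬ (y ≡ lookup xs k) → y ∈ removeAt xs k
  ∈-removeAt⁺ (x ∷ xs) zero (here refl) n = ⊥-elim (n refl)
  ∈-removeAt⁺ (x ∷ xs) zero (there p) n = p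
  ∈-removeAt⁺ (x ∷ xs) (suc k) (here refl) n = here refl
  ∈-removeAt⁺ (x ∷ xs) (suc k) (there p) n = there (∈-removeAt⁺ xs k p n)

  ∈-removeAt⁻ : ∀ {A : Set} (xs : List A) k {y} → y ∈ removeAt xs k → y ∈ xs
  ∈-removeAt⁻ (x ∷ xs) zero p = there p
  ∈-removeAt⁻ (x ∷ xs) (suc k) (here e) = here e
  ∈-removeAt⁻ (x ∷ xs) (suc k) (there p) = there (∈-removeAt⁻ xs k p)

  ∈-removeAt⇒≢ : ∀ {A : Set} (xs : List A) k {y} → Unique xs → y ∈ removeAt xs k → ¬ (y ≡ lookup xs k)
  ∈-removeAt⇒≢ (x ∷ xs) zero (a ∷ u) p e = All.lookup a p (sym e)
  ∈-removeAt⇒≢ (x ∷ xs) (suc k) (a ∷ u) (here refl) e = All.lookup a (∈-lookup k) e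
  ∈-removeAt⇒≢ (x ∷ xs) (suc k) (a ∷ u) (there p) e = ∈-removeAt⇒≢ xs k u p e

  convexPosition⇒∈ : ∀ {W} → ConvexPosition W → ConvexPosition∈ W
  convexPosition⇒∈ {W} convex {x} x∈W c = convex (Any.index x∈W) (subst (λ z → Cone (removeAt W (Any.index x∈W)) z 1ℚ) (AnyP.lookup-index x∈W) (cone-trans (λ {y} y∈ → cone-∈ (∈-removeAt⁺ W (Any.index x∈W) (proj₁ (∈-remove⁻ {x} {y} {W} y∈)) (λ e → proj₂ (∈-remove⁻ {x} {y} {W} y∈) (trans e (sym (AnyP.lookup-index x∈W)))))) c))

  convexPosition∈⇒ : ∀ {W} → Unique W → ConvexPosition∈ W → ConvexPosition W
  convexPosition∈⇒ {W} unique convex k c = convex (∈-lookup k) (cone-trans (λ {y} y∈ → cone-∈ (∈-remove⁺ (∈-removeAt⁻ W k y∈) (∈-removeAt⇒≢ W k unique y∈))) c)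

module HullOfGrid where

  open import Defs
  open RationalFacts
  open Cones
  open ExtremePoints
  open Triangle
  open GridCells
  open BoolFacts using (does-sound; Bool-ext)
  open import Relation.Nullary.Decidable using (dec-true)
  open import Data.Nat as ℕ using (ℕ; zero; suc)
  open import Data.Bool using (Bool; true)
  open import Data.Fin using (Fin; zero; suc)
  open import Data.Rational as ℚ using (ℚ; 0ℚ; 1ℚ; _≤_; _<_; _+_; _*_; _-_; -_)
  import Data.Rational.Properties as ℚP
  open import Data.Rational.Solver
  open +-*-Solver
  open import Data.List using (List; []; _∷_)
  open import Data.List.Relation.Unary.Any using (here; there)
  open import Data.List.Membership.Propositional using (_∈_; _∉_)
  open import Data.List.Membership.Propositional.Properties using (∈-filter⁻)
  open import Data.Vec as Vec using (Vec)
  import Data.Vec.Properties as VecP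
  open import Data.Product using (Σ; _×_; _,_; proj₁; proj₂)
  open import Data.Sum using (_⊎_; inj₁; inj₂)
  open import Data.Empty using (⊥; ⊥-elim)
  open import Relation.Nullary using (yes; no; Dec; does)
  open import Relation.Binary.PropositionalEquality hiding (J)
  open import Data.List.Membership.DecPropositional _≟ₚ_ using (_∈?_)

  cone-singleton : ∀ {a q} → Cone (a ∷ []) q 1ℚ → q ≡ a
  cone-singleton {a} x with cone-∷⁻ x
  ... | coneCons m q' c' m≥0 cone refl eqc with cone-[]⁻ cone
  ... | refl , refl = cong₂ _,_ (e (proj₁ a)) (e (proj₂ a))
    where
    m1 : m ≡ 1ℚ
    m1 = trans (sym (ℚP.+-identityʳ m)) (sym eqc)
    e : ∀ x → m * x + 0ℚ ≡ x
    e x = trans (ℚP.+-identityʳ _) (trans (cong (_* x) m1) (ℚP.*-identityˡ x))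

  module Members (i j : ℕ) (i≥1 : 1 ℕ.≤ i) (j≥1 : 1 ℕ.≤ j) (decConv : (V : List Pt) (q : Pt) → Dec (InConv V q)) where
    open Geometry i j i≥1 j≥1
    open Cells i j
    open Pruning decConv

    module MemberOfC (G : Grid i j) (inc : InC i j G) where
      convex : ConvexPosition (V G)
      convex = proj₁ inc
      hullΔ : ∀ q → InConv (V G) q → InΔ i j q
      hullΔ = proj₁ (proj₂ inc)
      avoids-legs : ∀ q → InConv (V G) q → OnHoriz i j q ⊎ OnVert i j q → (q ≡ O) ⊎ (q ≡ C)
      avoids-legs = proj₁ (proj₂ (proj₂ inc))
      O∈ : O ∈ V G
      O∈ = proj₁ (proj₂ (proj₂ (proj₂ (proj₂ inc))))
      C∈ : C ∈ V G
      C∈ = proj₁ (proj₂ (proj₂ (proj₂ (proj₂ (proj₂ inc)))))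
      convex∈ : ConvexPosition∈ (V G)
      convex∈ = convexPosition⇒∈ convex

      allowed′ : ∀ {y} → y ∈ V G → Dec (y ≡ O) → Dec (y ≡ C) → Allowed y
      allowed′ y∈ (yes e) _ = inj₁ e
      allowed′ y∈ (no _) (yes e) = inj₂ (inj₁ e)
      allowed′ {y} y∈ (no y≢O) (no y≢C) = inj₂ (inj₂ (y>0 , x<I , below-diagonal))
        where
        y∈Δ : InΔ i j y
        y∈Δ = hullΔ y (cone-∈ y∈)
        not-endpoint : (y ≡ O) ⊎ (y ≡ C) → ⊥
        not-endpoint (inj₁ e) = y≢O e
        not-endpoint (inj₂ e) = y≢C e
        y>0 : 0ℚ < proj₂ y
        y>0 = ≤∧≢⇒< (proj₁ y∈Δ) (λ e → not-endpoint (avoids-legs y (cone-∈ y∈) (inj₁ (sym e , InΔ⇒0≤x y∈Δ , proj₁ (proj₂ y∈Δ)))))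
        x<I : proj₁ y < I
        x<I = ≤∧≢⇒< (proj₁ (proj₂ y∈Δ)) (λ e → not-endpoint (avoids-legs y (cone-∈ y∈) (inj₂ (e , proj₁ y∈Δ , y≤J e))))
          where
          y≤J : proj₁ y ≡ I → proj₂ y ≤ J
          y≤J e = ℚP.*-cancelʳ-≤-pos I {{ℚ.positive I>0}} (subst (λ t → proj₂ y * I ≤ J * t) e (proj₂ (proj₂ y∈Δ)))
        -- On the diagonal, y would lie in [O, C] ⊆ conv (V G ∖ y).
        below-diagonal : proj₂ y * I < J * proj₁ y
        below-diagonal = ≤∧≢⇒< (proj₂ (proj₂ y∈Δ)) (λ e → convex∈ y∈ (cone-trans endpoints-remain (diagonal⇒∈OC y∈Δ e)))
          where
          endpoints-remain : ∀ {u} → u ∈ (O ∷ C ∷ []) → Cone (remove y (V G)) u 1ℚ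
          endpoints-remain (here refl) = cone-∈ (∈-remove⁺ O∈ (λ e → y≢O (sym e)))
          endpoints-remain (there (here refl)) = cone-∈ (∈-remove⁺ C∈ (λ e → y≢C (sym e)))

      allowed : ∀ {y} → y ∈ V G → Allowed y
      allowed {y} y∈ = allowed′ y∈ (y ≟ₚ O) (y ≟ₚ C)

    module HullGrid (S : Grid i j) where
      Vs : List Pt
      Vs = V S
      opaque
        spanning : SpanningSubset Vs
        spanning = spanningConvexSubset Vs
      R : List Pt
      R = SpanningSubset.pts spanning

      row : Fin (suc i) → Vec Bool (suc j)
      row a = Vec.tabulate (λ b → does (point (a , b) ∈? R))

      H : Grid i j
      H = Vec.tabulate row

      bit-H : ∀ pt → bit H pt ≡ does (point pt ∈? R)
      bit-H (a , b) = trans (cong (λ r → Vec.lookup r b) (VecP.lookup∘tabulate row a)) (VecP.lookup∘tabulate (λ b → does (point (a , b) ∈? R)) b)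

      does-true : ∀ {y} → does (y ∈? R) ≡ true → y ∈ R
      does-true {y} = does-sound (y ∈? R)

      does-true⁻ : ∀ {y} → y ∈ R → does (y ∈? R) ≡ true
      does-true⁻ {y} = dec-true (y ∈? R)

      VH : List Pt
      VH = V H

      VH→R : ∀ {y} → y ∈ VH → y ∈ R
      VH→R {y} p = from-cell (∈vertices⇒cell H p)
        where
        from-cell : Σ Cell (λ pt → (y ≡ point pt) × (bit H pt ≡ true)) → y ∈ R
        from-cell (pt , refl , b) = does-true (trans (sym (bit-H pt)) b)

      R→Vs : ∀ {y} → y ∈ R → y ∈ Vs
      R→Vs = SpanningSubset.pts⊆ spanning

      R→VH : ∀ {y} → y ∈ R → y ∈ VH
      R→VH {y} p = from-cell (∈vertices⇒cell S (R→Vs p)) p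
        where
        from-cell : Σ Cell (λ pt → (y ≡ point pt) × (bit S pt ≡ true)) → y ∈ R → y ∈ VH
        from-cell (pt , refl , b) p = bit⇒∈vertices H pt (trans (bit-H pt) (does-true⁻ p))

      R⊆VH : ∀ {q c} → Cone R q c → Cone VH q c
      R⊆VH = cone-trans (λ p → cone-∈ (R→VH p))
      S⊆hull : ∀ pt → bit S pt ≡ true → InConv VH (point pt)
      S⊆hull pt b = R⊆VH (SpanningSubset.spans spanning (bit⇒∈vertices S pt b))

      H⊆S : ∀ pt → bit H pt ≡ true → bit S pt ≡ true
      H⊆S pt b = ∈vertices⇒bit S pt (R→Vs (VH→R (bit⇒∈vertices H pt b)))

      convexPosition-VH : ConvexPosition∈ VH
      convexPosition-VH {x} x∈ c = SpanningSubset.convex spanning (VH→R x∈) (cone-trans (λ {y} y∈ → cone-∈ (∈-remove⁺ (VH→R (proj₁ (∈-remove⁻ {x} {y} {VH} y∈))) (proj₂ (∈-remove⁻ {x} {y} {VH} y∈)))) c)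

      module Admissible (allowed-S : ∀ {y} → y ∈ Vs → Allowed y) (O∈S : O ∈ Vs) (C∈S : C ∈ Vs) where
        allowed : ∀ {y} → y ∈ VH → Allowed y
        allowed p = allowed-S (R→Vs (VH→R p))

        -- O lies in conv VH, where x vanishes only at O; symmetrically for C and i - x.
        O∈ : O ∈ VH
        O∈ = by-decision (O ∈? VH)
          where
          x-pos : O ∉ VH → ∀ {v} → Allowed v → v ∈ VH → 0ℚ < affine 1ℚ 0ℚ 0ℚ v 1ℚ
          x-pos O∉ (inj₁ refl)        O∈VH = ⊥-elim (O∉ O∈VH)
          x-pos O∉ (inj₂ (inj₁ refl)) _    = C-x
          x-pos O∉ (inj₂ (inj₂ t))    _    = interior-x t
          by-decision : Dec (O ∈ VH) → O ∈ VH
          by-decision (yes O∈VH) = O∈VH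
          by-decision (no O∉VH)  = ⊥-elim (ℚP.<-irrefl (sym O-x)
            (affine-pos 1ℚ 0ℚ 0ℚ (λ p → x-pos O∉VH (allowed p) p) (R⊆VH (SpanningSubset.spans spanning O∈S)) 0<1))

        C∈ : C ∈ VH
        C∈ = by-decision (C ∈? VH)
          where
          right-pos : C ∉ VH → ∀ {v} → Allowed v → v ∈ VH → 0ℚ < affine (- 1ℚ) 0ℚ I v 1ℚ
          right-pos C∉ (inj₁ refl)        _    = O-r
          right-pos C∉ (inj₂ (inj₁ refl)) C∈VH = ⊥-elim (C∉ C∈VH)
          right-pos C∉ (inj₂ (inj₂ t))    _    = interior-right t
          by-decision : Dec (C ∈ VH) → C ∈ VH
          by-decision (yes C∈VH) = C∈VH
          by-decision (no C∉VH)  = ⊥-elim (ℚP.<-irrefl (sym C-r)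
            (affine-pos (- 1ℚ) 0ℚ I (λ p → right-pos C∉VH (allowed p) p) (R⊆VH (SpanningSubset.spans spanning C∈S)) 0<1))

        hullΔ : ∀ q → InConv VH q → InΔ i j q
        hullΔ q x = toInΔ (affine-nonNeg 0ℚ 1ℚ 0ℚ (λ p → allowed-y (allowed p)) x)
                          (affine-nonNeg (- 1ℚ) 0ℚ I (λ p → allowed-right (allowed p)) x)
                          (affine-nonNeg J (- I) 0ℚ (λ p → allowed-diag (allowed p)) x)

        face-within : ∀ α β γ {W} → (∀ {u} → Allowed u → affine α β γ u 1ℚ ≡ 0ℚ → u ∈ W) →
                      ∀ {u} → u ∈ face α β γ VH → Cone W u 1ℚ
        face-within α β γ onFace p with ∈-filter⁻ (λ v → affine α β γ v 1ℚ ℚP.≟ 0ℚ) {xs = VH} p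
        ... | u∈VH , vanishes = cone-∈ (onFace (allowed u∈VH) vanishes)

        on-bottom : ∀ {u} → Allowed u → affine 0ℚ 1ℚ 0ℚ u 1ℚ ≡ 0ℚ → u ∈ O ∷ []
        on-bottom (inj₁ refl)        _ = here refl
        on-bottom (inj₂ (inj₁ refl)) z = ⊥-elim (ℚP.<-irrefl (sym z) C-y)
        on-bottom (inj₂ (inj₂ t))    z = ⊥-elim (ℚP.<-irrefl (sym z) (interior-y t))

        on-right : ∀ {u} → Allowed u → affine (- 1ℚ) 0ℚ I u 1ℚ ≡ 0ℚ → u ∈ C ∷ []
        on-right (inj₁ refl)        z = ⊥-elim (ℚP.<-irrefl (sym z) O-r)
        on-right (inj₂ (inj₁ refl)) _ = here refl
        on-right (inj₂ (inj₂ t))    z = ⊥-elim (ℚP.<-irrefl (sym z) (interior-right t))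

        on-diagonal : ∀ {u} → Allowed u → affine J (- I) 0ℚ u 1ℚ ≡ 0ℚ → u ∈ O ∷ C ∷ []
        on-diagonal (inj₁ refl)        _ = here refl
        on-diagonal (inj₂ (inj₁ refl)) _ = there (here refl)
        on-diagonal (inj₂ (inj₂ t))    z = ⊥-elim (ℚP.<-irrefl (sym z) (interior-diag t))

        avoids-legs : ∀ q → InConv VH q → OnHoriz i j q ⊎ OnVert i j q → (q ≡ O) ⊎ (q ≡ C)
        avoids-legs q x (inj₁ (y≡0 , _ , _)) = inj₁ (cone-singleton (cone-trans (face-within 0ℚ 1ℚ 0ℚ on-bottom)
          (cone-face 0ℚ 1ℚ 0ℚ (λ p → allowed-y (allowed p)) x (trans (affine-y q) y≡0))))
        avoids-legs q x (inj₂ (x≡I , _ , _)) = inj₂ (cone-singleton (cone-trans (face-within (- 1ℚ) 0ℚ I on-right)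
          (cone-face (- 1ℚ) 0ℚ I (λ p → allowed-right (allowed p)) x (trans (affine-right q) (trans (cong (λ t → I - t) x≡I) (ℚP.+-inverseʳ I))))))

        lin-diag : ∀ q → lin (- J) I q ≡ 0ℚ - affine J (- I) 0ℚ q 1ℚ
        lin-diag q = identity I J (proj₁ q) (proj₂ q)
          where
          identity : ∀ I J x y → (- J) * x + I * y ≡ 0ℚ - (J * x + (- I) * y + 0ℚ * 1ℚ)
          identity = solve 4 (λ I J x y → (:- J) :* x :+ I :* y := con 0ℚ :- (J :* x :+ (:- I) :* y :+ con 0ℚ :* con 1ℚ)) refl

        -- The supporting line of the edge OC is - j x + i y = 0.
        edge : IsEdge VH O C
        edge = O≢C , O∈ , C∈ , - J , I , 0ℚ , (λ z → ℚP.<-irrefl (sym (proj₂ z)) I>0) ,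
          (λ q x → 0≤q-p⇒p≤q (subst (0ℚ ≤_) (sym (trans (cong (λ t → 0ℚ - t) (lin-diag q)) (0-[0-a]≡a (affine J (- I) 0ℚ q 1ℚ))))
                                      (affine-nonNeg J (- I) 0ℚ (λ p → allowed-diag (allowed p)) x))) ,
          (λ q x z → cone-trans (face-within J (- I) 0ℚ on-diagonal)
                       (cone-face J (- I) 0ℚ (λ p → allowed-diag (allowed p)) x (0-a≡0⇒a≡0 (trans (sym (lin-diag q)) z)))) ,
          lin-O I J , lin-C I J
          where
          0-[0-a]≡a : ∀ a → 0ℚ - (0ℚ - a) ≡ a
          0-[0-a]≡a = solve 1 (λ a → con 0ℚ :- (con 0ℚ :- a) := a) refl
          0-a≡0⇒a≡0 : ∀ {a} → 0ℚ - a ≡ 0ℚ → a ≡ 0ℚ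
          0-a≡0⇒a≡0 {a} z = trans (sym (0-[0-a]≡a a)) (trans (cong (λ t → 0ℚ - t) z) (ℚP.+-inverseʳ 0ℚ))
          lin-O : ∀ I J → (- J) * 0ℚ + I * 0ℚ ≡ 0ℚ
          lin-O = solve 2 (λ I J → (:- J) :* con 0ℚ :+ I :* con 0ℚ := con 0ℚ) refl
          lin-C : ∀ I J → (- J) * I + I * J ≡ 0ℚ
          lin-C = solve 2 (λ I J → (:- J) :* I :+ I :* J := con 0ℚ) refl

        hull∈C : InC i j H
        hull∈C = convexPosition∈⇒ (vertices-unique H) convexPosition-VH , hullΔ , avoids-legs , edge

      -- V G and the pruned list are both in convex position and span the same hull, so they coincide.
      hull-unique : ∀ G → InC i j G → (∀ pt → bit S pt ≡ true → InConv (V G) (point pt)) → (∀ pt → bit G pt ≡ true → bit S pt ≡ true) → ∀ pt → bit G pt ≡ bit H pt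
      hull-unique G G∈C S⊆G G⊆S pt = Bool-ext G⇒H H⇒G
        where
        VG→Vs : ∀ {y} → y ∈ V G → y ∈ Vs
        VG→Vs {y} p = from-cell (∈vertices⇒cell G p)
          where
          from-cell : Σ Cell (λ pt → (y ≡ point pt) × (bit G pt ≡ true)) → y ∈ Vs
          from-cell (pt' , refl , b) = bit⇒∈vertices S pt' (G⊆S pt' b)
        Vs→convG : ∀ {y} → y ∈ Vs → Cone (V G) y 1ℚ
        Vs→convG {y} p = from-cell (∈vertices⇒cell S p)
          where
          from-cell : Σ Cell (λ pt → (y ≡ point pt) × (bit S pt ≡ true)) → Cone (V G) y 1ℚ
          from-cell (pt' , refl , b) = S⊆G pt' b
        G→R : ∀ {y} → y ∈ V G → y ∈ R
        G→R = convexPosition-⊆ (MemberOfC.convex∈ G G∈C) (λ p → SpanningSubset.spans spanning (VG→Vs p)) (λ p → Vs→convG (R→Vs p))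
        R→G : ∀ {y} → y ∈ R → y ∈ V G
        R→G = convexPosition-⊆ (SpanningSubset.convex spanning) (λ p → Vs→convG (R→Vs p)) (λ p → SpanningSubset.spans spanning (VG→Vs p))
        G⇒H : bit G pt ≡ true → bit H pt ≡ true
        G⇒H b = ∈vertices⇒bit H pt (R→VH (G→R (bit⇒∈vertices G pt b)))
        H⇒G : bit H pt ≡ true → bit G pt ≡ true
        H⇒G b = ∈vertices⇒bit G pt (R→G (VH→R (bit⇒∈vertices H pt b)))

module Counting where

  open import Defs
  open BoolFacts using (true≢false)
  open import Data.Nat as ℕ using (ℕ; suc)
  import Data.Nat.Properties as ℕP
  open import Data.Bool using (Bool; true; false; _∧_; not; if_then_else_)
  open import Data.List using (List; []; _∷_; map; filter; length)
  open import Data.List.Relation.Unary.Any using (here; there)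
  open import Data.List.Relation.Unary.All as All using (All)
  open import Data.List.Relation.Unary.AllPairs using ([]; _∷_)
  open import Data.List.Relation.Unary.Unique.Propositional using (Unique)
  open import Data.List.Membership.Propositional using (_∈_)
  open import Data.Sum using (_⊎_; inj₁; inj₂)
  open import Data.Empty using (⊥; ⊥-elim)
  open import Relation.Nullary using (¬_; Dec; does)
  open import Relation.Binary.PropositionalEquality

  count : ∀ {A : Set} → (A → Bool) → List A → ℕ
  count f [] = 0
  count f (x ∷ xs) = if f x then suc (count f xs) else count f xs

  count-cong : ∀ {A : Set} {f g : A → Bool} (L : List A) → (∀ x → f x ≡ g x) → count f L ≡ count g L
  count-cong [] h = refl
  count-cong {f = f} {g} (x ∷ xs) h rewrite h x = cong (λ c → if g x then suc c else c) (count-cong xs h)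

  length-filter≡count : ∀ {A : Set} {P : A → Set} (d : ∀ x → Dec (P x)) (L : List A) → length (filter d L) ≡ count (λ x → does (d x)) L
  length-filter≡count d [] = refl
  length-filter≡count d (x ∷ xs) with does (d x)
  ... | true = cong suc (length-filter≡count d xs)
  ... | false = length-filter≡count d xs

  length-filter-map≡count : ∀ {A B : Set} {P : B → Set} (d : ∀ x → Dec (P x)) (f : A → B) (L : List A) → length (filter d (map f L)) ≡ count (λ x → does (d (f x))) L
  length-filter-map≡count d f [] = refl
  length-filter-map≡count d f (x ∷ xs) with does (d (f x))
  ... | true = cong suc (length-filter-map≡count d f xs)
  ... | false = length-filter-map≡count d f xs

  count-split : ∀ {A : Set} (g t : A → Bool) (L : List A) → count g L ≡ count (λ x → g x ∧ t x) L ℕ.+ count (λ x → g x ∧ not (t x)) L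
  count-split g t [] = refl
  count-split g t (x ∷ xs) with g x | t x
  ... | true | true = cong suc (count-split g t xs)
  ... | true | false = trans (cong suc (count-split g t xs)) (sym (ℕP.+-suc _ _))
  ... | false | _ = count-split g t xs

  count≡0 : ∀ {A : Set} (f : A → Bool) (L : List A) → (∀ {x} → x ∈ L → f x ≡ true → ⊥) → count f L ≡ 0
  count≡0 f [] h = refl
  count≡0 f (x ∷ xs) h with f x in e
  ... | true = ⊥-elim (h (here refl) e)
  ... | false = count≡0 f xs (λ p → h (there p))

  count≡1 : ∀ {A : Set} (f : A → Bool) (L : List A) {a} → Unique L → a ∈ L → f a ≡ true → (∀ {x} → x ∈ L → f x ≡ true → x ≡ a) → count f L ≡ 1
  count≡1 f (x ∷ xs) {a} (ax ∷ u) a∈ fa h with f x in e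
  ... | true = cong suc (count≡0 f xs (λ {y} y∈ fy → All.lookup ax y∈ (trans (h (here refl) e) (sym (h (there y∈) fy)))))
  ... | false = count≡1 f xs u (a∈xs a∈) fa (λ p → h (there p))
    where
    a∈xs : a ∈ x ∷ xs → a ∈ xs
    a∈xs (here refl) = ⊥-elim (true≢false (trans (sym fa) e))
    a∈xs (there p) = p

  count≡2 : ∀ {A : Set} (f : A → Bool) (L : List A) {a b} → Unique L → a ∈ L → b ∈ L → ¬ (a ≡ b) → f a ≡ true → f b ≡ true → (∀ {x} → x ∈ L → f x ≡ true → (x ≡ a) ⊎ (x ≡ b)) → count f L ≡ 2
  count≡2 f (x ∷ xs) {a} {b} (ax ∷ u) a∈ b∈ a≢b fa inFibre h with f x in e
  ... | false = count≡2 f xs u (strip a∈ fa) (strip b∈ inFibre) a≢b fa inFibre (λ p → h (there p))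
    where
    strip : ∀ {c} → c ∈ x ∷ xs → f c ≡ true → c ∈ xs
    strip (here refl) fc = ⊥-elim (true≢false (trans (sym fc) e))
    strip (there p) fc = p
  ... | true with h (here refl) e
  ...   | inj₁ refl = cong suc (count≡1 f xs u (b∈xs b∈) inFibre (λ {y} y∈ fy → h2 y∈ (h (there y∈) fy)))
    where
    b∈xs : b ∈ x ∷ xs → b ∈ xs
    b∈xs (here refl) = ⊥-elim (a≢b refl)
    b∈xs (there p) = p
    h2 : ∀ {y} → y ∈ xs → (y ≡ x) ⊎ (y ≡ b) → y ≡ b
    h2 y∈ (inj₁ refl) = ⊥-elim (All.lookup ax y∈ refl)
    h2 y∈ (inj₂ e) = e
  ...   | inj₂ refl = cong suc (count≡1 f xs u (a∈xs a∈) fa (λ {y} y∈ fy → h2 y∈ (h (there y∈) fy)))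
    where
    a∈xs : a ∈ x ∷ xs → a ∈ xs
    a∈xs (here refl) = ⊥-elim (a≢b refl)
    a∈xs (there p) = p
    h2 : ∀ {y} → y ∈ xs → (y ≡ a) ⊎ (y ≡ x) → y ≡ a
    h2 y∈ (inj₁ e) = e
    h2 y∈ (inj₂ refl) = ⊥-elim (All.lookup ax y∈ refl)

module PointWeights where

  open import Defs
  open PolynomialAlgebra
  open BigOperators
  open BoolFacts using (true≢false)
  open Counting using (count)
  open import Data.Nat using (ℕ; suc)
  open import Data.Bool using (Bool; true; false; _∧_; _∨_; not; if_then_else_)
  open import Data.List using (List; []; _∷_)
  open import Data.Empty using (⊥-elim)
  open import Relation.Binary.PropositionalEquality

  -- weight endpoint? interior? chosen?: an endpoint of L must be chosen, an interior point
  -- of Δ weighs 1 - x if chosen and x if not, and any other cell must not be chosen.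
  weight : Bool → Bool → Bool → Poly
  weight true  _     true  = pone
  weight true  _     false = []
  weight false true  true  = oneMinusX
  weight false true  false = px
  weight false false true  = []
  weight false false false = pone

  admissible : Bool → Bool → Bool → Bool
  admissible true  _     chosen = chosen
  admissible false true  _      = true
  admissible false false chosen = not chosen

  -- fibreWeight uncovered? vertex? interior?: what a cell contributes once all sets S with
  -- vertices(P) ⊆ S ⊆ P are summed; at a non-vertex interior point of P the two choices
  -- contribute (1 - x) + x = 1.
  fibreWeight : Bool → Bool → Bool → Poly
  fibreWeight true  _     _     = px
  fibreWeight false true  true  = oneMinusX
  fibreWeight false true  false = pone
  fibreWeight false false _     = pone

  weight-sum : ∀ endpoint interior → weight endpoint interior true ⊕ weight endpoint interior false ≈ pone
  weight-sum true  _     = ≈-refl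
  weight-sum false true  = oneMinusX⊕px≈pone
  weight-sum false false = ≈-refl

  weight-admissible : ∀ endpoint interior chosen →
    weight endpoint interior chosen ≈ indicator (admissible endpoint interior chosen) ⊗ weight endpoint interior chosen
  weight-admissible true  _     true  = ≈-sym (⊗-identityˡ _)
  weight-admissible true  _     false = ≈-refl
  weight-admissible false true  true  = ≈-sym (⊗-identityˡ _)
  weight-admissible false true  false = ≈-sym (⊗-identityˡ _)
  weight-admissible false false true  = ≈-refl
  weight-admissible false false false = ≈-sym (⊗-identityˡ _)

  -- covered? says whether the cell lies in P; the hypotheses are what membership of P in C
  -- guarantees about its endpoints and vertices.
  fibreWeight-at : ∀ endpoint interior covered vertex →
    (endpoint ≡ true → covered ≡ true) → (endpoint ≡ true → vertex ≡ true) →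
    (vertex ≡ true → covered ≡ true) → (vertex ≡ true → (endpoint ∨ interior) ≡ true) →
    (endpoint ≡ true → interior ≡ false) →
    (indicator covered ⊗ weight endpoint interior true) ⊕ (indicator (not vertex) ⊗ weight endpoint interior false)
      ≈ fibreWeight (interior ∧ not covered) vertex interior
  fibreWeight-at true interior covered vertex e⇒c e⇒v _ _ e⇒¬i
    rewrite e⇒c refl | e⇒v refl | e⇒¬i refl = ≈-trans (⊕-identityʳ (pone ⊗ pone)) (⊗-identityˡ pone)
  fibreWeight-at false true  true  true  _ _ _ _ _ = ≈-trans (⊕-identityʳ _) (⊗-identityˡ oneMinusX)
  fibreWeight-at false true  true  false _ _ _ _ _ = ≈-trans (⊕-cong (⊗-identityˡ oneMinusX) (⊗-identityˡ px)) oneMinusX⊕px≈pone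
  fibreWeight-at false true  false true  _ _ v⇒c _ _ = ⊥-elim (true≢false (sym (v⇒c refl)))
  fibreWeight-at false true  false false _ _ _ _ _ = ⊗-identityˡ px
  fibreWeight-at false false _     true  _ _ _ v⇒e∨i _ = ⊥-elim (true≢false (sym (v⇒e∨i refl)))
  fibreWeight-at false false true  false _ _ _ _ _ = ⊗-identityˡ pone
  fibreWeight-at false false false false _ _ _ _ _ = ⊗-identityˡ pone

  Π-fibreWeight : ∀ {A : Set} (uncovered vertex interior : A → Bool) (L : List A) →
    Πl L (λ x → fibreWeight (uncovered x) (vertex x) (interior x))
      ≈ (px ^ᵖ count uncovered L) ⊗ (oneMinusX ^ᵖ count (λ x → not (uncovered x) ∧ (vertex x ∧ interior x)) L)
  Π-fibreWeight u v t [] = ≈-sym (⊗-identityˡ pone)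
  Π-fibreWeight u v t (x ∷ xs) =
    ≈-trans (⊗-congʳ (fibreWeight (u x) (v x) (t x)) (Π-fibreWeight u v t xs)) (step (u x) (v x) (t x))
    where
    m n : ℕ
    m = count u xs
    n = count (λ x → not (u x) ∧ (v x ∧ t x)) xs
    P Q : Poly
    P = px ^ᵖ m
    Q = oneMinusX ^ᵖ n
    step : ∀ ux vx tx → fibreWeight ux vx tx ⊗ (P ⊗ Q)
      ≈ (px ^ᵖ (if ux then suc m else m)) ⊗ (oneMinusX ^ᵖ (if not ux ∧ (vx ∧ tx) then suc n else n))
    step true  _     _     = ≈-sym (⊗-assoc px P Q)
    step false true  true  = ≈-trans (≈-sym (⊗-assoc oneMinusX P Q))
                               (≈-trans (⊗-congˡ Q (⊗-comm oneMinusX P)) (⊗-assoc P oneMinusX Q))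
    step false true  false = ⊗-identityˡ _
    step false false _     = ⊗-identityˡ _

open import Defs
open import Data.Nat using (ℕ; _≤_; _<_; _∸_)
open import Data.Nat.Properties using (m<n⇒0<n∸m)
open import Data.List using (List)
open import Relation.Nullary using (Dec)
open import Relation.Binary.PropositionalEquality using (_≡_)

module BooleanIndicators where

  open import Defs
  open PolynomialAlgebra
  open BigOperators
  open BoolFacts using (∧-true⁻)
  open import Data.Nat using (ℕ; zero; suc)
  open import Data.Bool using (Bool; true; false; _∧_)
  open import Data.Fin using (Fin; zero; suc)
  open import Data.Product using (proj₁; proj₂)
  open import Function using (_∘_)
  open import Relation.Binary.PropositionalEquality

  indicator-∧ : ∀ a b → indicator a ⊗ indicator b ≈ indicator (a ∧ b)
  indicator-∧ true  b = ⊗-identityˡ (indicator b)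
  indicator-∧ false b = ≈-refl

  allFin? : (n : ℕ) → (Fin n → Bool) → Bool
  allFin? zero    β = true
  allFin? (suc n) β = β zero ∧ allFin? n (β ∘ suc)

  ΠF-indicator : ∀ n (β : Fin n → Bool) → ΠF n (λ k → indicator (β k)) ≈ indicator (allFin? n β)
  ΠF-indicator zero    β = ≈-refl
  ΠF-indicator (suc n) β = ≈-trans (⊗-congʳ (indicator (β zero)) (ΠF-indicator n (β ∘ suc))) (indicator-∧ (β zero) _)

  allFin?-sound : ∀ n (β : Fin n → Bool) → allFin? n β ≡ true → ∀ k → β k ≡ true
  allFin?-sound (suc n) β all zero    = proj₁ (∧-true⁻ all)
  allFin?-sound (suc n) β all (suc k) = allFin?-sound n (β ∘ suc) (proj₂ (∧-true⁻ {β zero} all)) k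

  allFin?-complete : ∀ n (β : Fin n → Bool) → (∀ k → β k ≡ true) → allFin? n β ≡ true
  allFin?-complete zero    β h = refl
  allFin?-complete (suc n) β h rewrite h zero = allFin?-complete n (β ∘ suc) (h ∘ suc)

module GridProducts (i j : ℕ) where

  open import Defs
  open PolynomialAlgebra
  open BigOperators
  open BooleanIndicators
  open GridCells
  open Cells i j
  open VectorSums i j
  open import Data.Nat using (suc)
  open import Data.Bool using (Bool; true; false)
  open import Data.List using (List; []; _∷_; map; allFin)
  open import Data.Product using (_,_)
  import Data.Vec as Vec
  open import Function using (id)
  open import Relation.Binary.PropositionalEquality

  Grids : List (Grid i j)
  Grids = allGrids i j

  ΠG : (Cell → Poly) → Poly
  ΠG f = ΠF (suc i) (λ a → ΠF (suc j) (λ b → f (a , b)))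

  ΠG-cong : ∀ {f g : Cell → Poly} → (∀ pt → f pt ≈ g pt) → ΠG f ≈ ΠG g
  ΠG-cong h = ΠF-cong (suc i) (λ a → ΠF-cong (suc j) (λ b → h (a , b)))

  ΠG-⊗ : ∀ (f g : Cell → Poly) → ΠG f ⊗ ΠG g ≈ ΠG (λ pt → f pt ⊗ g pt)
  ΠG-⊗ f g = ≈-trans (ΠF-⊗ (suc i) (λ a → ΠF (suc j) (λ b → f (a , b))) (λ a → ΠF (suc j) (λ b → g (a , b))))
                     (ΠF-cong (suc i) (λ a → ΠF-⊗ (suc j) (λ b → f (a , b)) (λ b → g (a , b))))

  ΠG-one : ∀ {f : Cell → Poly} → (∀ pt → f pt ≈ pone) → ΠG f ≈ pone
  ΠG-one h = ≈-trans (ΠF-cong (suc i) (λ a → ΠF-one (suc j) (λ b → h (a , b)))) (ΠF-one (suc i) (λ a → ≈-refl))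

  allCells? : (Cell → Bool) → Bool
  allCells? β = allFin? (suc i) (λ a → allFin? (suc j) (λ b → β (a , b)))

  ΠG-indicator : ∀ (β : Cell → Bool) → ΠG (λ pt → indicator (β pt)) ≈ indicator (allCells? β)
  ΠG-indicator β = ≈-trans (ΠF-cong (suc i) (λ a → ΠF-indicator (suc j) (λ b → β (a , b))))
                           (ΠF-indicator (suc i) (λ a → allFin? (suc j) (λ b → β (a , b))))

  allCells?-sound : ∀ β → allCells? β ≡ true → ∀ pt → β pt ≡ true
  allCells?-sound β all (a , b) =
    allFin?-sound (suc j) (λ b → β (a , b)) (allFin?-sound (suc i) (λ a → allFin? (suc j) (λ b → β (a , b))) all a) b

  allCells?-complete : ∀ β → (∀ pt → β pt ≡ true) → allCells? β ≡ true
  allCells?-complete β h =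
    allFin?-complete (suc i) (λ a → allFin? (suc j) (λ b → β (a , b))) (λ a → allFin?-complete (suc j) (λ b → β (a , b)) (λ b → h (a , b)))

  Σ-grids-ΠG : ∀ (F : Cell → Bool → Poly) → Σl Grids (λ S → ΠG (λ pt → F pt (bit S pt))) ≈ ΠG (λ pt → F pt true ⊕ F pt false)
  Σ-grids-ΠG F =
    ≈-trans (Σ-allVecs-ΠF (suc i) (allVecs i j (suc j) (true ∷ false ∷ [])) (λ a row → ΠF (suc j) (λ b → F (a , b) (Vec.lookup row b))))
      (ΠF-cong (suc i) (λ a → ≈-trans (Σ-allVecs-ΠF (suc j) (true ∷ false ∷ []) (λ b → F (a , b)))
        (ΠF-cong (suc j) (λ b → ⊕-cong (≈-refl {F (a , b) true}) (⊕-identityʳ (F (a , b) false))))))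

  ΠG≈Πl : ∀ (f : Cell → Poly) → ΠG f ≈ Πl (gridPts i j) f
  ΠG≈Πl f = ≈-sym (begin
    Πl (gridPts i j) f
      ≈⟨ Πl-concatMap (λ a → map (λ b → a , b) (allFin (suc j))) (allFin (suc i)) f ⟩
    Πl (allFin (suc i)) (λ a → Πl (map (λ b → a , b) (allFin (suc j))) f)
      ≈⟨ Πl-cong (allFin (suc i)) (λ a → ≡⇒≈ (trans (Πl-map (λ b → a , b) (allFin (suc j)) f) (Πl-tab (suc j) id (λ b → f (a , b))))) ⟩
    Πl (allFin (suc i)) (λ a → ΠF (suc j) (λ b → f (a , b)))
      ≡⟨ Πl-tab (suc i) id (λ a → ΠF (suc j) (λ b → f (a , b))) ⟩
    ΠG f ∎)
    where open ≈-Reasoning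

module FibreSum (i j : ℕ) (i≥1 : 1 ≤ i) (j≥1 : 1 ≤ j)
                (decConv : (V : List Pt) (q : Pt) → Dec (InConv V q))
                (decC : (S : Grid i j) → Dec (InC i j S)) where

  import Data.Nat as ℕ
  import Data.Nat.Properties as ℕP
  open import Data.Bool using (Bool; true; false; _∧_; _∨_; not; T?)
  open import Data.Bool.Properties using () renaming (_≟_ to _≟ᵇ_)
  open import Data.Fin using (zero; fromℕ)
  import Data.Fin.Properties as FinP
  open import Data.Rational as ℚ using (0ℚ)
  open import Data.List using ([]; length; map; filterᵇ)
  open import Data.List.Properties using (length-map)
  open import Data.List.Membership.Propositional using (_∈_)
  open import Data.Sum using (_⊎_; inj₁; inj₂)
  open import Data.Product using (Σ; _×_; _,_; proj₁; proj₂)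
  open import Data.Empty using (⊥-elim)
  open import Relation.Nullary using (¬_; yes; no; does)
  open import Relation.Nullary.Decidable using (dec-true; dec-false)
  open import Function using (_∘_)
  open import Relation.Binary.PropositionalEquality hiding (J)

  open PolynomialAlgebra
  open BigOperators
  open BoolFacts
  open Counting
  open PointWeights
  open BooleanIndicators
  open Cones
  open ExtremePoints
  open Triangle
  open GridCells
  open HullOfGrid
  open Geometry i j i≥1 j≥1
  open Cells i j
  open Members i j i≥1 j≥1 decConv
  open GridProducts i j

  ×-dec₃ : ∀ {A B C : Set} → Dec A → Dec B → Dec C → Dec (A × B × C)
  ×-dec₃ (yes a) (yes b) (yes c) = yes (a , b , c)
  ×-dec₃ (no ¬a) _       _       = no (¬a ∘ proj₁)
  ×-dec₃ (yes _) (no ¬b) _       = no (¬b ∘ proj₁ ∘ proj₂)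
  ×-dec₃ (yes _) (yes _) (no ¬c) = no (¬c ∘ proj₂ ∘ proj₂)

  interior? : (q : Pt) → Dec (Interior q)
  interior? q = ×-dec₃ (0ℚ ℚ.<? proj₂ q) (proj₁ q ℚ.<? I) (proj₂ q ℚ.* I ℚ.<? J ℚ.* proj₁ q)

  decU-spec : ∀ W q → does (decU i j decConv W q) ≡ (does (interior? q) ∧ not (does (decConv W q)))
  decU-spec W (x , y) with 0ℚ ℚ.<? y | x ℚ.<? I | y ℚ.* I ℚ.<? J ℚ.* x | decConv W (x , y)
  ... | yes _ | yes _ | yes _ | no _  = refl
  ... | yes _ | yes _ | yes _ | yes _ = refl
  ... | no _  | _     | _     | _     = refl
  ... | yes _ | no _  | _     | _     = refl
  ... | yes _ | yes _ | no _  | _     = refl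

  isEndpoint : Pt → Bool
  isEndpoint P = does (P ≟ₚ O) ∨ does (P ≟ₚ C)

  isEndpoint-sound : ∀ P → isEndpoint P ≡ true → (P ≡ O) ⊎ (P ≡ C)
  isEndpoint-sound P = sound (P ≟ₚ O) (P ≟ₚ C)
    where
    sound : (d₁ : Dec (P ≡ O)) (d₂ : Dec (P ≡ C)) → (does d₁ ∨ does d₂) ≡ true → (P ≡ O) ⊎ (P ≡ C)
    sound (yes P≡O) _         _ = inj₁ P≡O
    sound (no _)    (yes P≡C) _ = inj₂ P≡C

  isEndpoint-O : isEndpoint O ≡ true
  isEndpoint-O = ∨-trueˡ {b = does (O ≟ₚ C)} (dec-true (O ≟ₚ O) refl)

  isEndpoint-C : isEndpoint C ≡ true
  isEndpoint-C = ∨-trueʳ {does (C ≟ₚ O)} (dec-true (C ≟ₚ C) refl)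

  isInterior : Pt → Bool
  isInterior P = does (interior? P)

  weightAt : Pt → Bool → Poly
  weightAt P = weight (isEndpoint P) (isInterior P)

  weightOf : Grid i j → Poly
  weightOf S = ΠG (λ pt → weightAt (point pt) (bit S pt))

  -- fibre G S is 1 exactly when vertices(G) ⊆ S ⊆ conv G, and 0 otherwise.
  inFibre : Grid i j → Cell → Bool → Bool
  inFibre G pt true  = does (decConv (V G) (point pt))
  inFibre G pt false = not (bit G pt)

  fibre : Grid i j → Grid i j → Poly
  fibre G S = ΠG (λ pt → indicator (inFibre G pt (bit S pt)))

  isUncovered : Grid i j → Cell → Bool
  isUncovered G pt = does (decU i j decConv (V G) (point pt))

  fibreWeightOf : Grid i j → Cell → Poly
  fibreWeightOf G pt = fibreWeight (isUncovered G pt) (bit G pt) (isInterior (point pt))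

  cellO cellC : Cell
  cellO = (zero , zero)
  cellC = (fromℕ i , fromℕ j)

  point-cellO : point cellO ≡ O
  point-cellO = refl

  point-cellC : point cellC ≡ C
  point-cellC = cong₂ latt (FinP.toℕ-fromℕ i) (FinP.toℕ-fromℕ j)

  cellO≢cellC : cellO ≢ cellC
  cellO≢cellC e = O≢C (trans (sym point-cellO) (trans (cong point e) point-cellC))

  module FibreOfMember (G : Grid i j) (inc : InC i j G) where
    open MemberOfC G inc

    vertex-in-hull : ∀ {P} → P ∈ V G → does (decConv (V G) P) ≡ true
    vertex-in-hull {P} p = dec-true (decConv (V G) P) (cone-∈ p)

    endpoint⇒vertex : ∀ pt → isEndpoint (point pt) ≡ true → point pt ∈ V G
    endpoint⇒vertex pt e = by-endpoint (isEndpoint-sound (point pt) e)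
      where
      by-endpoint : (point pt ≡ O) ⊎ (point pt ≡ C) → point pt ∈ V G
      by-endpoint (inj₁ x) = subst (_∈ V G) (sym x) O∈
      by-endpoint (inj₂ x) = subst (_∈ V G) (sym x) C∈

    allowed⇒endpoint∨interior : ∀ {P} → Allowed P → (isEndpoint P ∨ isInterior P) ≡ true
    allowed⇒endpoint∨interior (inj₁ refl) = ∨-trueˡ {isEndpoint O} {isInterior O} isEndpoint-O
    allowed⇒endpoint∨interior (inj₂ (inj₁ refl)) = ∨-trueˡ {isEndpoint C} {isInterior C} isEndpoint-C
    allowed⇒endpoint∨interior {P} (inj₂ (inj₂ t)) = ∨-trueʳ {isEndpoint P} (dec-true (interior? P) t)

    endpoint⇒¬interior : ∀ P → isEndpoint P ≡ true → isInterior P ≡ false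
    endpoint⇒¬interior P e = by-endpoint (isEndpoint-sound P e)
      where
      by-endpoint : (P ≡ O) ⊎ (P ≡ C) → isInterior P ≡ false
      by-endpoint (inj₁ refl) = dec-false (interior? O) O-not-interior
      by-endpoint (inj₂ refl) = dec-false (interior? C) C-not-interior

    fibreWeight-cell : ∀ pt → (indicator (inFibre G pt true) ⊗ weightAt (point pt) true) ⊕ (indicator (inFibre G pt false) ⊗ weightAt (point pt) false) ≈ fibreWeightOf G pt
    fibreWeight-cell pt = subst (λ u → (indicator (inFibre G pt true) ⊗ weightAt (point pt) true) ⊕ (indicator (inFibre G pt false) ⊗ weightAt (point pt) false) ≈ fibreWeight u (bit G pt) (isInterior (point pt)))
      (sym (decU-spec (V G) (point pt)))
      (fibreWeight-at (isEndpoint (point pt)) (isInterior (point pt)) (does (decConv (V G) (point pt))) (bit G pt)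
        (λ e → vertex-in-hull (endpoint⇒vertex pt e))
        (λ e → ∈vertices⇒bit G pt (endpoint⇒vertex pt e))
        (λ e → vertex-in-hull (bit⇒∈vertices G pt e))
        (λ e → allowed⇒endpoint∨interior (allowed (bit⇒∈vertices G pt e)))
        (endpoint⇒¬interior (point pt)))

    boundaryVertex : Cell → Bool
    boundaryVertex pt = bit G pt ∧ not (isInterior (point pt))

    boundaryVertex-O : boundaryVertex cellO ≡ true
    boundaryVertex-O = ∧-not-true (∈vertices⇒bit G cellO O∈) (dec-false (interior? O) O-not-interior)
    boundaryVertex-C : boundaryVertex cellC ≡ true
    boundaryVertex-C = ∧-not-true (∈vertices⇒bit G cellC (subst (_∈ V G) (sym point-cellC) C∈)) (dec-false (interior? (point cellC)) (subst (λ z → ¬ Interior z) (sym point-cellC) C-not-interior))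

    boundaryVertex⇒ : ∀ {pt} → pt ∈ gridPts i j → boundaryVertex pt ≡ true → (pt ≡ cellO) ⊎ (pt ≡ cellC)
    boundaryVertex⇒ {pt} _ e = by-cases (allowed (bit⇒∈vertices G pt (proj₁ (∧-true⁻ e)))) (proj₂ (∧-true⁻ {bit G pt} e))
      where
      by-cases : Allowed (point pt) → not (isInterior (point pt)) ≡ true → (pt ≡ cellO) ⊎ (pt ≡ cellC)
      by-cases (inj₁ x) _ = inj₁ (point-injective (trans x (sym point-cellO)))
      by-cases (inj₂ (inj₁ x)) _ = inj₂ (point-injective (trans x (sym point-cellC)))
      by-cases (inj₂ (inj₂ t)) n = ⊥-elim (true≢false (trans (sym n) (cong not (dec-true (interior? (point pt)) t))))

    vertex-split : ∀ g t c → (g ≡ true → c ≡ true) → (g ∧ t) ≡ (not (t ∧ not c) ∧ (g ∧ t))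
    vertex-split true  true  true  _    = refl
    vertex-split true  true  false g⇒c  = ⊥-elim (true≢false (sym (g⇒c refl)))
    vertex-split true  false _     _    = refl
    vertex-split false true  true  _    = refl
    vertex-split false true  false _    = refl
    vertex-split false false _     _    = refl

    interiorVertex : Cell → Bool
    interiorVertex pt = not (isUncovered G pt) ∧ (bit G pt ∧ isInterior (point pt))

    count-interior-vertices : count (λ pt → bit G pt ∧ isInterior (point pt)) (gridPts i j) ≡ count interiorVertex (gridPts i j)
    count-interior-vertices = count-cong (gridPts i j) (λ pt →
      trans (vertex-split (bit G pt) (isInterior (point pt)) (does (decConv (V G) (point pt))) (λ e → vertex-in-hull (bit⇒∈vertices G pt e)))
            (cong (λ u → not u ∧ (bit G pt ∧ isInterior (point pt))) (sym (decU-spec (V G) (point pt)))))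

    v≡count+2 : v i j decConv G ≡ count (λ pt → bit G pt ∧ isInterior (point pt)) (gridPts i j) ℕ.+ 2
    v≡count+2 = begin
      length (map point (selectedCells G))                       ≡⟨ length-map point (selectedCells G) ⟩
      length (filterᵇ (bit G) (gridPts i j))           ≡⟨ length-filter≡count (T? ∘ bit G) (gridPts i j) ⟩
      count (bit G) (gridPts i j)                      ≡⟨ count-split (bit G) (λ pt → isInterior (point pt)) (gridPts i j) ⟩
      count interiorCell (gridPts i j) ℕ.+ count boundaryVertex (gridPts i j)
        ≡⟨ cong (count interiorCell (gridPts i j) ℕ.+_) (count≡2 boundaryVertex (gridPts i j) gridPts-unique
             (gridPts-complete cellO) (gridPts-complete cellC) cellO≢cellC boundaryVertex-O boundaryVertex-C boundaryVertex⇒) ⟩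
      count interiorCell (gridPts i j) ℕ.+ 2           ∎
      where
      open ≡-Reasoning
      interiorCell : Cell → Bool
      interiorCell pt = bit G pt ∧ isInterior (point pt)

    v∸2≡count : v i j decConv G ℕ.∸ 2 ≡ count interiorVertex (gridPts i j)
    v∸2≡count = trans (cong (ℕ._∸ 2) v≡count+2) (trans (ℕP.m+n∸n≡m _ 2) count-interior-vertices)

    u≡count : u i j decConv G ≡ count (isUncovered G) (gridPts i j)
    u≡count = length-filter-map≡count (decU i j decConv (V G)) point (gridPts i j)

    Σ-fibre≈term : Σl Grids (λ S → fibre G S ⊗ weightOf S) ≈ term i j decConv G
    Σ-fibre≈term = begin
      Σl Grids (λ S → fibre G S ⊗ weightOf S)
        ≈⟨ Σl-cong Grids (λ {S} _ → ΠG-⊗ (λ pt → indicator (inFibre G pt (bit S pt))) (λ pt → weightAt (point pt) (bit S pt))) ⟩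
      Σl Grids (λ S → ΠG (λ pt → indicator (inFibre G pt (bit S pt)) ⊗ weightAt (point pt) (bit S pt)))
        ≈⟨ Σ-grids-ΠG (λ pt b → indicator (inFibre G pt b) ⊗ weightAt (point pt) b) ⟩
      ΠG (λ pt → (indicator (inFibre G pt true) ⊗ weightAt (point pt) true) ⊕ (indicator (inFibre G pt false) ⊗ weightAt (point pt) false))
        ≈⟨ ΠG-cong fibreWeight-cell ⟩
      ΠG (fibreWeightOf G)
        ≈⟨ ΠG≈Πl (fibreWeightOf G) ⟩
      Πl (gridPts i j) (fibreWeightOf G)
        ≈⟨ Π-fibreWeight (isUncovered G) (bit G) (λ pt → isInterior (point pt)) (gridPts i j) ⟩
      (px ^ᵖ count (isUncovered G) (gridPts i j)) ⊗ (oneMinusX ^ᵖ count interiorVertex (gridPts i j))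
        ≡⟨ cong₂ (λ a b → (px ^ᵖ a) ⊗ (oneMinusX ^ᵖ b)) u≡count v∸2≡count ⟨
      term i j decConv G ∎
      where open ≈-Reasoning

  admissibleAt : Grid i j → Cell → Bool
  admissibleAt S pt = admissible (isEndpoint (point pt)) (isInterior (point pt)) (bit S pt)

  admissible-true : ∀ endpoint interior → admissible endpoint interior true ≡ true → (endpoint ≡ true) ⊎ (interior ≡ true)
  admissible-true true  _    _ = inj₁ refl
  admissible-true false true _ = inj₂ refl

  module FibreOfGrid (S : Grid i j) (adm : allCells? (admissibleAt S) ≡ true) where
    open HullGrid S

    admissibleAt-true : ∀ pt → admissibleAt S pt ≡ true
    admissibleAt-true = allCells?-sound (admissibleAt S) adm

    allowed-S : ∀ {y} → y ∈ Vs → Allowed y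
    allowed-S {y} p = from-cell (∈vertices⇒cell S p)
      where
      endpoint-allowed : ∀ {P} → (P ≡ O) ⊎ (P ≡ C) → Allowed P
      endpoint-allowed (inj₁ P≡O) = inj₁ P≡O
      endpoint-allowed (inj₂ P≡C) = inj₂ (inj₁ P≡C)
      chosen-allowed : ∀ pt → (isEndpoint (point pt) ≡ true) ⊎ (isInterior (point pt) ≡ true) → Allowed (point pt)
      chosen-allowed pt (inj₁ e) = endpoint-allowed (isEndpoint-sound (point pt) e)
      chosen-allowed pt (inj₂ t) = inj₂ (inj₂ (does-sound (interior? (point pt)) t))
      from-cell : Σ Cell (λ pt → (y ≡ point pt) × (bit S pt ≡ true)) → Allowed y
      from-cell (pt , refl , b) = chosen-allowed pt (admissible-true (isEndpoint (point pt)) (isInterior (point pt))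
        (subst (λ z → admissible (isEndpoint (point pt)) (isInterior (point pt)) z ≡ true) b (admissibleAt-true pt)))

    endpoint∈S : ∀ pt → isEndpoint (point pt) ≡ true → bit S pt ≡ true
    endpoint∈S pt e = subst (λ o → admissible o (isInterior (point pt)) (bit S pt) ≡ true) e (admissibleAt-true pt)

    O∈S : O ∈ Vs
    O∈S = bit⇒∈vertices S cellO (endpoint∈S cellO isEndpoint-O)

    C∈S : C ∈ Vs
    C∈S = subst (_∈ Vs) point-cellC (bit⇒∈vertices S cellC (endpoint∈S cellC (subst (λ z → isEndpoint z ≡ true) (sym point-cellC) isEndpoint-C)))

    open Admissible allowed-S O∈S C∈S using (hull∈C)

    inFibreOfS : Grid i j → Cell → Bool
    inFibreOfS G pt = inFibre G pt (bit S pt)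

    inFibre-false : ∀ G pt b → inFibre G pt b ≡ true → bit G pt ≡ true → b ≡ true
    inFibre-false G pt true e g = refl
    inFibre-false G pt false e g = ⊥-elim (true≢false (trans (sym e) (cong not g)))

    member⇒hull : ∀ G → (does (decC G) ∧ allCells? (inFibreOfS G)) ≡ true → allCells? (λ pt → does (bit G pt ≟ᵇ bit H pt)) ≡ true
    member⇒hull G e = allCells?-complete _ (λ pt → dec-true (bit G pt ≟ᵇ bit H pt) (G≡H pt))
      where
      G∈C : InC i j G
      G∈C = does-sound (decC G) (proj₁ (∧-true⁻ e))
      inFibre-G : ∀ pt → inFibreOfS G pt ≡ true
      inFibre-G = allCells?-sound (inFibreOfS G) (proj₂ (∧-true⁻ {does (decC G)} e))
      S⊆G : ∀ pt → bit S pt ≡ true → InConv (V G) (point pt)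
      S⊆G pt b = does-sound (decConv (V G) (point pt)) (subst (λ z → inFibre G pt z ≡ true) b (inFibre-G pt))
      G⊆S : ∀ pt → bit G pt ≡ true → bit S pt ≡ true
      G⊆S pt g = inFibre-false G pt (bit S pt) (inFibre-G pt) g
      G≡H : ∀ pt → bit G pt ≡ bit H pt
      G≡H = hull-unique G G∈C S⊆G G⊆S

    inFibre-hull : ∀ pt b → bit S pt ≡ b → inFibre H pt b ≡ true
    inFibre-hull pt true e = dec-true (decConv (V H) (point pt)) (S⊆hull pt e)
    inFibre-hull pt false e = nb (bit H pt) refl
      where
      nb : ∀ c → bit H pt ≡ c → not c ≡ true
      nb true h = ⊥-elim (true≢false (trans (sym (H⊆S pt h)) e))
      nb false h = refl

    hull⇒member : ∀ G → allCells? (λ pt → does (bit G pt ≟ᵇ bit H pt)) ≡ true → (does (decC G) ∧ allCells? (inFibreOfS G)) ≡ true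
    hull⇒member G e = subst (λ X → (does (decC X) ∧ allCells? (inFibreOfS X)) ≡ true) (sym G≡H) H-member
      where
      G≡H : G ≡ H
      G≡H = grid-ext (λ pt → does-sound (bit G pt ≟ᵇ bit H pt) (allCells?-sound (λ pt → does (bit G pt ≟ᵇ bit H pt)) e pt))
      H-member : (does (decC H) ∧ allCells? (inFibreOfS H)) ≡ true
      H-member = subst (λ z → (z ∧ allCells? (inFibreOfS H)) ≡ true) (sym (dec-true (decC H) hull∈C))
                   (allCells?-complete (inFibreOfS H) (λ pt → inFibre-hull pt (bit S pt) refl))

    member-indicator : ∀ G → indicator (does (decC G)) ⊗ fibre G S ≈ ΠG (λ pt → indicator (does (bit G pt ≟ᵇ bit H pt)))
    member-indicator G = begin
      indicator (does (decC G)) ⊗ fibre G S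
        ≈⟨ ⊗-congʳ (indicator (does (decC G))) (ΠG-indicator (inFibreOfS G)) ⟩
      indicator (does (decC G)) ⊗ indicator (allCells? (inFibreOfS G))
        ≈⟨ indicator-∧ (does (decC G)) (allCells? (inFibreOfS G)) ⟩
      indicator (does (decC G) ∧ allCells? (inFibreOfS G))
        ≡⟨ cong indicator (Bool-ext (member⇒hull G) (hull⇒member G)) ⟩
      indicator (allCells? (λ pt → does (bit G pt ≟ᵇ bit H pt)))
        ≈⟨ ΠG-indicator (λ pt → does (bit G pt ≟ᵇ bit H pt)) ⟨
      ΠG (λ pt → indicator (does (bit G pt ≟ᵇ bit H pt))) ∎
      where open ≈-Reasoning

    ≟ᵇ-sum : ∀ c → indicator (does (true ≟ᵇ c)) ⊕ indicator (does (false ≟ᵇ c)) ≈ pone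
    ≟ᵇ-sum true  = ≈-refl
    ≟ᵇ-sum false = ≈-refl

    unique-member : Σl Grids (λ G → indicator (does (decC G)) ⊗ fibre G S) ≈ pone
    unique-member = begin
      Σl Grids (λ G → indicator (does (decC G)) ⊗ fibre G S)
        ≈⟨ Σl-cong Grids (λ {G} _ → member-indicator G) ⟩
      Σl Grids (λ G → ΠG (λ pt → indicator (does (bit G pt ≟ᵇ bit H pt))))
        ≈⟨ Σ-grids-ΠG (λ pt b → indicator (does (b ≟ᵇ bit H pt))) ⟩
      ΠG (λ pt → indicator (does (true ≟ᵇ bit H pt)) ⊕ indicator (does (false ≟ᵇ bit H pt)))
        ≈⟨ ΠG-one (λ pt → ≟ᵇ-sum (bit H pt)) ⟩
      pone ∎
      where open ≈-Reasoning

  isMember : Grid i j → Poly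
  isMember G = indicator (does (decC G))

  term-as-fibreSum : ∀ G (d : Dec (InC i j G)) →
    indicator (does d) ⊗ term i j decConv G ≈ indicator (does d) ⊗ Σl Grids (λ S → fibre G S ⊗ weightOf S)
  term-as-fibreSum G (yes G∈C) = ⊗-congʳ pone (≈-sym (FibreOfMember.Σ-fibre≈term G G∈C))
  term-as-fibreSum G (no _)    = ≈-refl

  weightOf-admissible : ∀ S → weightOf S ≈ indicator (allCells? (admissibleAt S)) ⊗ weightOf S
  weightOf-admissible S = begin
    weightOf S
      ≈⟨ ΠG-cong (λ pt → weight-admissible (isEndpoint (point pt)) (isInterior (point pt)) (bit S pt)) ⟩
    ΠG (λ pt → indicator (admissibleAt S pt) ⊗ weightAt (point pt) (bit S pt))
      ≈⟨ ΠG-⊗ (λ pt → indicator (admissibleAt S pt)) (λ pt → weightAt (point pt) (bit S pt)) ⟨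
    ΠG (λ pt → indicator (admissibleAt S pt)) ⊗ weightOf S
      ≈⟨ ⊗-congˡ (weightOf S) (ΠG-indicator (admissibleAt S)) ⟩
    indicator (allCells? (admissibleAt S)) ⊗ weightOf S ∎
    where open ≈-Reasoning

  -- An admissible S lies in exactly one fibre, that of its hull; an inadmissible S weighs 0.
  members-over-weight : ∀ S (b : Bool) → allCells? (admissibleAt S) ≡ b →
    Σl Grids (λ G → isMember G ⊗ fibre G S) ⊗ weightOf S ≈ weightOf S
  members-over-weight S true adm = ≈-trans (⊗-congˡ (weightOf S) (FibreOfGrid.unique-member S adm)) (⊗-identityˡ (weightOf S))
  members-over-weight S false inadm =
    ≈-trans (⊗-congʳ (Σl Grids (λ G → isMember G ⊗ fibre G S)) weight≈0)
      (≈-trans (⊗-zeroʳ (Σl Grids (λ G → isMember G ⊗ fibre G S))) (≈-sym weight≈0))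
    where
    weight≈0 : weightOf S ≈ []
    weight≈0 = ≈-trans (weightOf-admissible S) (subst (λ b → indicator b ⊗ weightOf S ≈ []) (sym inadm) ≈-refl)

  fibres-partition : ∀ S → Σl Grids (λ G → isMember G ⊗ (fibre G S ⊗ weightOf S)) ≈ weightOf S
  fibres-partition S = begin
    Σl Grids (λ G → isMember G ⊗ (fibre G S ⊗ weightOf S))
      ≈⟨ Σl-cong Grids (λ {G} _ → ⊗-assoc (isMember G) (fibre G S) (weightOf S)) ⟨
    Σl Grids (λ G → (isMember G ⊗ fibre G S) ⊗ weightOf S)
      ≈⟨ Σl-⊗ (weightOf S) Grids (λ G → isMember G ⊗ fibre G S) ⟨
    Σl Grids (λ G → isMember G ⊗ fibre G S) ⊗ weightOf S
      ≈⟨ members-over-weight S (allCells? (admissibleAt S)) refl ⟩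
    weightOf S ∎
    where open ≈-Reasoning

  sumC≈pone : sumC i j decConv decC ≈ pone
  sumC≈pone = begin
    sumC i j decConv decC
      ≈⟨ Σl-filter decC Grids (term i j decConv) ⟩
    Σl Grids (λ G → isMember G ⊗ term i j decConv G)
      ≈⟨ Σl-cong Grids (λ {G} _ → term-as-fibreSum G (decC G)) ⟩
    Σl Grids (λ G → isMember G ⊗ Σl Grids (λ S → fibre G S ⊗ weightOf S))
      ≈⟨ Σl-cong Grids (λ {G} _ → ⊗-Σl (isMember G) Grids (λ S → fibre G S ⊗ weightOf S)) ⟩
    Σl Grids (λ G → Σl Grids (λ S → isMember G ⊗ (fibre G S ⊗ weightOf S)))
      ≈⟨ Σl-swap Grids Grids (λ G S → isMember G ⊗ (fibre G S ⊗ weightOf S)) ⟩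
    Σl Grids (λ S → Σl Grids (λ G → isMember G ⊗ (fibre G S ⊗ weightOf S)))
      ≈⟨ Σl-cong Grids (λ {S} _ → fibres-partition S) ⟩
    Σl Grids weightOf
      ≈⟨ Σ-grids-ΠG (λ pt → weightAt (point pt)) ⟩
    ΠG (λ pt → weightAt (point pt) true ⊕ weightAt (point pt) false)
      ≈⟨ ΠG-one (λ pt → weight-sum (isEndpoint (point pt)) (isInterior (point pt))) ⟩
    pone ∎
    where open ≈-Reasoning

lemma1p4 : (i n : ℕ) → 1 ≤ i → i < n →
    (decConv : (V : List Pt) (q : Pt) → Dec (InConv V q)) →
    (decC : (S : Grid i (n ∸ i)) → Dec (InC i (n ∸ i) S)) →
    (k : ℕ) → coeff (sumC i (n ∸ i) decConv decC) k ≡ coeff pone k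
lemma1p4 i n 1≤i i<n decConv decC =
  PolynomialAlgebra.at (FibreSum.sumC≈pone i (n ∸ i) 1≤i (m<n⇒0<n∸m i<n) decConv decC)
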